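{- Let $m\ge 3$ be odd and $n\ge 6$ even with $n_1=n/2$ even; let $n_0=n_1-1$. Let $(a_1,\dots,a_{n_0})$ be one of the following sequences, where $1\le k\le n_1/2$ for odd indices $2k-1$ and $1\le k\le n_1/2-1$ for even indices $2k$: (1) $a_{2k-1}=mn$, $a_{2k}=mn+2$; (2) $a_{2k-1}=mn-1$, $a_{2k}=mn+3$; (3) $a_{2k-1}=m(n-1)+1$, $a_{2k}=m(n+1)+1$; (4) $a_{2k-1}=m(n-2)+1$, $a_{2k}=m(n+2)+1$. Then $(a_1,\dots,a_{n_0})$ is a palindrome, there exists an $(a_1,\dots,a_{n_0})$-admissible path partition $K$ of $G(a_1,\dots,a_{n_0})$, and there exist $2^{m-1}(m-1)!$ pairwise Klein bottle nonequivalent $C_4$-face-magic Klein bottle labelings $X$ of $\mathcal{K}_{m,n}$ with $\mathcal{L}(X)=K$.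
   Context: $\mathcal{K}_{m,n}$: vertex set $\{(i,j):1\le i\le m,1\le j\le n\}$, edges $(i,j)(i,j+1)$ ($j\le n-1$), $(i,n)(i,1)$, $(i,j)(i+1,j)$ ($i\le m-1$), $(m,j)(1,n+1-j)$. Its $4$-cycle faces (column indices mod $n$): $\{(i,j),(i,j+1),(i+1,j),(i+1,j+1)\}$, $1\le i\le m-1$, and $\{(m,j),(m,j+1),(1,n+1-j),(1,n-j)\}$. A $C_4$-face-magic Klein bottle labeling is a bijection $(i,j)\mapsto x_{i,j}$ onto $\{1,\dots,mn\}$ with all these face sums equal. Equivalence: with $U(i,j)=(i+1,j)$ ($i<m$), $U(m,j)=(1,n+1-j)$, $H(i,j)=(i,j+n/2)$ (mod $n$), $F(i,j)=(i,n+1-j)$, $KBLS(m,n)=\langle U,H,F\rangle$; labelings $X,X'$ are Klein bottle equivalent if $X'=\{x_{A(i,j)}\}$ for some $A\in KBLS(m,n)$. $G(a_1,\dots,a_{n_0})$: vertex set $\{\{q,mn+1-q\}:1\le q\le mn/2\}$; distinct vertices $\{x_1,x_2\},\{y_1,y_2\}$ are adjacent iff $z_1+z_2=a_j$ for some $z_1\in\{x_1,x_2\}$, $z_2\in\{y_1,y_2\}$, $1\le j\le n_0$. A path on $n_1$ distinct vertices $V_1,\dots,V_{n_1}$ (in order) is $(a_1,\dots,a_{n_0})$-admissible if there are $z_j\in V_j$ with $z_j+z_{j+1}=a_j$ for $1\le j\le n_0$. An admissible path partition is a spanning subgraph that is a disjoint union of $m$ distinct admissible paths. For a $C_4$-face-magic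 labeling $X$, $\mathcal{L}(X)$ is the graph on the same vertex set with edges between $\{x_{2i-1,j},mn+1-x_{2i-1,j}\}$ and $\{x_{2i-1,j+1},mn+1-x_{2i-1,j+1}\}$ for $1\le i\le(m+1)/2$, $1\le j\le n_0$, and between $\{x_{2i,n+1-j},mn+1-x_{2i,n+1-j}\}$ and $\{x_{2i,n-j},mn+1-x_{2i,n-j}\}$ for $1\le i\le(m-1)/2$, $1\le j\le n_0$. A sequence is a palindrome if it equals its reversal. -}

module Defs where

open import Data.Nat
open import Data.Nat.Divisibility using (_∣_)
open import Data.Bool using (if_then_else_)
open import Data.Product using (Σ; proj₁; proj₂; ∃; ∃-syntax; _×_; _,_)
open import Data.Sum using (_⊎_)
open import Data.List using (List; map; upTo; reverse; foldr)
open import Data.Fin using (Fin)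
open import Relation.Binary.PropositionalEquality using (_≡_)
open import Relation.Nullary using (¬_)
open import Function.Bundles using (_⇔_)

-- All indices are 1-based natural numbers, as in the paper.
-- A labeling is a function (i , j) ↦ x_{i,j}; only 1 ≤ i ≤ m, 1 ≤ j ≤ n matters.
Labeling : Set
Labeling = ℕ → ℕ → ℕ

InRange : ℕ → ℕ → ℕ → ℕ → Set
InRange m n i j = 1 ≤ i × i ≤ m × 1 ≤ j × j ≤ n

-- column index taken mod n, represented in 1..n  (col n 0 = n, col n (n+1) = 1)
col : ℕ → ℕ → ℕ
col zero j = j
col n@(suc _) j = suc ((j + n ∸ 1) % n)

IsBijectiveLabeling : ℕ → ℕ → Labeling → Set
IsBijectiveLabeling m n X =
  (∀ i j → InRange m n i j → 1 ≤ X i j × X i j ≤ m * n) ×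
  (∀ i j i' j' → InRange m n i j → InRange m n i' j' →
     X i j ≡ X i' j' → i ≡ i' × j ≡ j') ×
  (∀ v → 1 ≤ v → v ≤ m * n → ∃[ i ] ∃[ j ] (InRange m n i j × X i j ≡ v))

FaceMagic : ℕ → ℕ → Labeling → Set
FaceMagic m n X = ∃[ s ]
  ((∀ i j → 1 ≤ i → i ≤ m ∸ 1 → 1 ≤ j → j ≤ n →
      X i j + X i (col n (suc j)) + X (suc i) j + X (suc i) (col n (suc j)) ≡ s) ×
   (∀ j → 1 ≤ j → j ≤ n →
      X m j + X m (col n (suc j)) + X 1 (col n (n + 1 ∸ j)) + X 1 (col n (n ∸ j)) ≡ s))

C4FaceMagicKBLabeling : ℕ → ℕ → Labeling → Set
C4FaceMagicKBLabeling m n X = IsBijectiveLabeling m n X × FaceMagic m n X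

data Gen : Set where
  U H F : Gen

act : ℕ → ℕ → Gen → ℕ × ℕ → ℕ × ℕ
act m n U (i , j) = if i <ᵇ m then (suc i , j) else (1 , n + 1 ∸ j)
act m n H (i , j) = (i , col n (j + n / 2))
act m n F (i , j) = (i , n + 1 ∸ j)

applyWord : ℕ → ℕ → List Gen → ℕ × ℕ → ℕ × ℕ
applyWord m n w p = foldr (act m n) p w

KBEquivalent : ℕ → ℕ → Labeling → Labeling → Set
KBEquivalent m n X X' = Σ (List Gen) λ w →
  (∀ i j → InRange m n i j →
     X' i j ≡ X (proj₁ (applyWord m n w (i , j))) (proj₂ (applyWord m n w (i , j))))

-- the vertex {x, N+1-x} of G is represented by its smaller element
vtx : ℕ → ℕ → ℕ
vtx N x = x ⊓ (N + 1 ∸ x)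

IsVertex : ℕ → ℕ → Set
IsVertex N u = 1 ≤ u × u ≤ N / 2

UPair : ℕ → ℕ → ℕ → ℕ → Set
UPair u v p q = (u ≡ p × v ≡ q) ⊎ (u ≡ q × v ≡ p)

Graph : Set₁
Graph = ℕ → ℕ → Set

SameGraph : Graph → Graph → Set
SameGraph E E' = ∀ u v → E u v ⇔ E' u v

n₀ : ℕ → ℕ
n₀ n = n / 2 ∸ 1

GEdge : ℕ → ℕ → (ℕ → ℕ) → Graph
GEdge N k a u v = IsVertex N u × IsVertex N v × ¬ u ≡ v ×
  Σ ℕ λ z₁ → Σ ℕ λ z₂ → Σ ℕ λ j →
    ((z₁ ≡ u ⊎ z₁ ≡ N + 1 ∸ u) × (z₂ ≡ v ⊎ z₂ ≡ N + 1 ∸ v) ×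
     1 ≤ j × j ≤ k × z₁ + z₂ ≡ a j)

AdmissiblePath : ℕ → ℕ → (ℕ → ℕ) → (ℕ → ℕ) → Set
AdmissiblePath N k a V =
  (∀ j → 1 ≤ j → j ≤ suc k → IsVertex N (V j)) ×
  (∀ j j' → 1 ≤ j → j ≤ suc k → 1 ≤ j' → j' ≤ suc k → V j ≡ V j' → j ≡ j') ×
  Σ (ℕ → ℕ) λ z → ((∀ j → 1 ≤ j → j ≤ suc k → z j ≡ V j ⊎ z j ≡ N + 1 ∸ V j) ×
          (∀ j → 1 ≤ j → j ≤ k → z j + z (suc j) ≡ a j))

AdmissiblePathPartition : ℕ → ℕ → (ℕ → ℕ) → Graph → Set
AdmissiblePathPartition m n a K =
  (∀ u v → K u v → GEdge (m * n) (n₀ n) a u v) ×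
  Σ (ℕ → ℕ → ℕ) λ P →
    (∀ i → 1 ≤ i → i ≤ m → AdmissiblePath (m * n) (n₀ n) a (P i)) ×
    (∀ i i' j j' → 1 ≤ i → i ≤ m → 1 ≤ i' → i' ≤ m →
       1 ≤ j → j ≤ suc (n₀ n) → 1 ≤ j' → j' ≤ suc (n₀ n) →
       P i j ≡ P i' j' → i ≡ i') ×
    (∀ u → IsVertex (m * n) u →
       ∃[ i ] ∃[ j ] (1 ≤ i × i ≤ m × 1 ≤ j × j ≤ suc (n₀ n) × P i j ≡ u)) ×
    (∀ u v → K u v ⇔
       (∃[ i ] ∃[ j ] (1 ≤ i × i ≤ m × 1 ≤ j × j ≤ n₀ n × UPair u v (P i j) (P i (suc j)))))

LGraph : ℕ → ℕ → Labeling → Graph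
LGraph m n X u v =
  (∃[ i ] ∃[ j ] (1 ≤ i × i ≤ (m + 1) / 2 × 1 ≤ j × j ≤ n₀ n ×
     UPair u v (vtx (m * n) (X (2 * i ∸ 1) j)) (vtx (m * n) (X (2 * i ∸ 1) (suc j))))) ⊎
  (∃[ i ] ∃[ j ] (1 ≤ i × i ≤ (m ∸ 1) / 2 × 1 ≤ j × j ≤ n₀ n ×
     UPair u v (vtx (m * n) (X (2 * i) (n + 1 ∸ j))) (vtx (m * n) (X (2 * i) (n ∸ j)))))

SeqCase : ℕ → ℕ → (ℕ → ℕ) → Set
SeqCase m n a = ∃[ α ] ∃[ β ]
  ((α ≡ m * n × β ≡ m * n + 2) ⊎
   (α ≡ m * n ∸ 1 × β ≡ m * n + 3) ⊎
   (α ≡ m * (n ∸ 1) + 1 × β ≡ m * (n + 1) + 1) ⊎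
   (α ≡ m * (n ∸ 2) + 1 × β ≡ m * (n + 2) + 1)) ×
  (∀ k → 1 ≤ k → k ≤ (n / 2) / 2 → a (2 * k ∸ 1) ≡ α) ×
  (∀ k → 1 ≤ k → k ≤ (n / 2) / 2 ∸ 1 → a (2 * k) ≡ β)

aSeq : ℕ → (ℕ → ℕ) → List ℕ
aSeq n a = map (λ j → a (suc j)) (upTo (n₀ n))

Palindrome : List ℕ → Set
Palindrome l = l ≡ reverse l

-- Write n = 2K and N = mn. Column c and its mirror n + 1 − c share the pair index
-- min(c, n + 1 − c) ∈ [1, K], and a column is determined by its pair index and its parity.
-- Split the vertices {x + 1, N − x} of G into m arithmetic progressions
-- x = base t 0 + d l (t < m, l < K). Row i of X walks along progression σ(i), forwards or
-- backwards, and takes x + 1 or N − x according to the parity of i + c. On every face two entries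
-- are of the form x + 1 and two of the form N − y, and they cancel because the progressions are
-- arithmetic: all face sums are 2(N + 1). Consecutive entries of a row sum alternately to
-- N + 1 − d and N + 1 + d, which is the sequence (a_j) for d = 1, 2, m, 2m, and the rows of X are
-- the paths of K. Fixing σ(1) and the direction of row 1 fixes x_{1,1}; every element of
-- KBLS(m, n) commutes with U, so an equivalence between two such labelings fixes the first column,
-- which determines σ and the directions. Hence the 2^{m−1}(m−1)! choices for the other rows give
-- pairwise inequivalent labelings.

module Submission where

open import Defs
open import Data.Nat
open import Data.Nat.Properties
open import Data.Nat.DivMod
open import Data.Nat.Divisibility using (_∣_; divides; divides-refl)
open import Data.Nat.Tactic.RingSolver using (solve-∀)
open import Data.Bool using (Bool; true; false; not; _xor_; T; if_then_else_)
open import Data.Bool.Properties using (not-involutive; not-injective; not-¬; not-distribˡ-xor; not-distribʳ-xor; xor-same)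
import Data.Bool.Properties as Bool
open import Data.Fin using (Fin; toℕ)
open import Data.Fin.Properties using (toℕ<n; toℕ-injective)
open import Data.List using (List; []; _∷_; _++_; map; upTo; applyUpTo; reverse)
open import Data.List.Properties using (map-applyUpTo; reverse-++)
open import Data.Product using (Σ; ∃; ∃-syntax; _×_; _,_; proj₁; proj₂)
open import Data.Sum using (_⊎_; inj₁; inj₂)
open import Data.Unit using (tt)
open import Data.Empty using (⊥-elim)
open import Function.Bundles using (mk⇔)
open import Relation.Binary.PropositionalEquality
open import Relation.Nullary

-- Parity and halving

isOdd : ℕ → Bool
isOdd zero = false
isOdd (suc n) = not (isOdd n)

isOdd-+ : ∀ a b → isOdd (a + b) ≡ isOdd a xor isOdd b
isOdd-+ zero b = refl
isOdd-+ (suc a) b = trans (cong not (isOdd-+ a b)) (not-distribˡ-xor (isOdd a) (isOdd b))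

isOdd-double : ∀ k → isOdd (k + k) ≡ false
isOdd-double k = trans (isOdd-+ k k) (xor-same (isOdd k))

mutual
  even⇒double : ∀ r → isOdd r ≡ false → ∃ λ h → r ≡ h + h
  even⇒double zero _ = 0 , refl
  even⇒double (suc r) e with odd⇒suc-double r (not-injective e)
  ... | h , refl = suc h , cong suc (sym (+-suc h h))

  odd⇒suc-double : ∀ r → isOdd r ≡ true → ∃ λ h → r ≡ suc (h + h)
  odd⇒suc-double (suc r) e with even⇒double r (not-injective e)
  ... | h , refl = h , refl

xor-cancelˡ : ∀ a x y → a xor x ≡ a xor y → x ≡ y
xor-cancelˡ false x y e = e
xor-cancelˡ true x y e = not-injective e

xor-cancelʳ : ∀ x y b → x xor b ≡ y xor b → x ≡ y
xor-cancelʳ x y b e = xor-cancelˡ b x y (trans (Bool.xor-comm b x) (trans e (Bool.xor-comm y b)))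

xor-solve : ∀ a b s → (a xor ((a xor b) xor s)) xor b ≡ s
xor-solve true true true = refl
xor-solve true true false = refl
xor-solve true false true = refl
xor-solve true false false = refl
xor-solve false true true = refl
xor-solve false true false = refl
xor-solve false false true = refl
xor-solve false false false = refl

isOdd⇒1≤ : ∀ m → isOdd m ≡ true → 1 ≤ m
isOdd⇒1≤ (suc m) _ = s≤s z≤n

≤∸1⇒< : ∀ {i m} → 1 ≤ m → i ≤ m ∸ 1 → i < m
≤∸1⇒< {m = suc m} _ i≤m = s≤s i≤m

double≡*2 : ∀ h → h + h ≡ h * 2
double≡*2 = solve-∀

double/2 : ∀ h → (h + h) / 2 ≡ h
double/2 h = trans (cong (_/ 2) (double≡*2 h)) (m*n/n≡m h 2)

¬2∣⇒isOdd : ∀ m → ¬ 2 ∣ m → isOdd m ≡ true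
¬2∣⇒isOdd m ¬2∣m with isOdd m in eq
... | true = refl
... | false with even⇒double m eq
...   | h , refl = ⊥-elim (¬2∣m (divides h (double≡*2 h)))

double-≤ : ∀ i h → i + i ≤ h + h → i ≤ h
double-≤ i h p with i ≤? h
... | yes i≤h = i≤h
... | no i≰h = ⊥-elim (<⇒≱ (+-mono-< (≰⇒> i≰h) (≰⇒> i≰h)) p)

1≤double⇒1≤ : ∀ q → 1 ≤ q + q → 1 ≤ q
1≤double⇒1≤ (suc _) _ = s≤s z≤n

double-< : ∀ i h → i + i < h + h → i < h
double-< i h p with i <? h
... | yes i<h = i<h
... | no i≮h = ⊥-elim (<⇒≱ p (+-mono-≤ (≮⇒≥ i≮h) (≮⇒≥ i≮h)))

2*[1+i]∸1 : ∀ i → 2 * suc i ∸ 1 ≡ suc (i + i)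
2*[1+i]∸1 i = cong (_∸ 1) (expand i)
  where
  expand : ∀ i → 2 * suc i ≡ suc (suc (i + i))
  expand = solve-∀

2*≡double : ∀ i → 2 * i ≡ i + i
2*≡double = solve-∀

module OddRows (m : ℕ) (m-odd : isOdd m ≡ true) where

  private
    h : ℕ
    h = proj₁ (odd⇒suc-double m m-odd)

    m≡ : m ≡ suc (h + h)
    m≡ = proj₂ (odd⇒suc-double m m-odd)

    [m+1]/2≡ : (m + 1) / 2 ≡ suc h
    [m+1]/2≡ = trans (cong (λ z → (z + 1) / 2) m≡) (trans (cong (_/ 2) (regroup h)) (double/2 (suc h)))
      where
      regroup : ∀ h → suc (h + h) + 1 ≡ suc h + suc h
      regroup = solve-∀

    [m∸1]/2≡ : (m ∸ 1) / 2 ≡ h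
    [m∸1]/2≡ = trans (cong (λ z → (z ∸ 1) / 2) m≡) (double/2 h)

  row-cases : ∀ r → 1 ≤ r → r ≤ m →
    (∃ λ i → 1 ≤ i × i ≤ (m + 1) / 2 × r ≡ 2 * i ∸ 1) ⊎ (∃ λ i → 1 ≤ i × i ≤ (m ∸ 1) / 2 × r ≡ 2 * i)
  row-cases r 1≤r r≤m with isOdd r in eq
  ... | true with odd⇒suc-double r eq
  ...   | i , refl = inj₁ (suc i , s≤s z≤n , subst (suc i ≤_) (sym [m+1]/2≡) (s≤s i≤h) , sym (2*[1+i]∸1 i))
    where
    i≤h : i ≤ h
    i≤h = double-≤ i h (≤-pred (subst (suc (i + i) ≤_) m≡ r≤m))
  row-cases r 1≤r r≤m | false with even⇒double r eq
  ...   | zero , refl = ⊥-elim (<⇒≱ 1≤r z≤n)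
  ...   | suc i , refl = inj₂ (suc i , s≤s z≤n , subst (suc i ≤_) (sym [m∸1]/2≡) i≤h , sym (2*≡double (suc i)))
    where
    i≤h : suc i ≤ h
    i≤h = double-< i h (subst (_≤ h + h) (+-suc i i) (≤-pred (subst (suc i + suc i ≤_) m≡ r≤m)))

  odd-row-range : ∀ i → 1 ≤ i → i ≤ (m + 1) / 2 → 1 ≤ 2 * i ∸ 1 × 2 * i ∸ 1 ≤ m
  odd-row-range (suc i) _ i≤ rewrite 2*[1+i]∸1 i =
    s≤s z≤n , subst (suc (i + i) ≤_) (sym m≡) (s≤s (+-mono-≤ i≤h i≤h))
    where
    i≤h : i ≤ h
    i≤h = ≤-pred (subst (suc i ≤_) [m+1]/2≡ i≤)

  even-row-range : ∀ i → 1 ≤ i → i ≤ (m ∸ 1) / 2 → 1 ≤ 2 * i × 2 * i ≤ m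
  even-row-range i 1≤i i≤ rewrite 2*≡double i =
    ≤-trans 1≤i (m≤m+n i i) , subst (i + i ≤_) (sym m≡) (≤-trans (+-mono-≤ i≤h i≤h) (n≤1+n _))
    where
    i≤h : i ≤ h
    i≤h = subst (i ≤_) [m∸1]/2≡ i≤

-- Columns and their mirror images

col-id : ∀ n j → 1 ≤ j → j ≤ n → col n j ≡ j
col-id (suc n) (suc j) _ j<n = cong suc (trans ([m+n]%n≡m%n j (suc n)) (m<n⇒m%n≡m j<n))

col-+ : ∀ n j → col n (j + n) ≡ col n j
col-+ zero j = +-identityʳ j
col-+ (suc n) j = cong suc (trans (cong (_% suc n) eq) ([m+n]%n≡m%n (j + suc n ∸ 1) (suc n)))
  where
  eq : j + suc n + suc n ∸ 1 ≡ j + suc n ∸ 1 + suc n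
  eq rewrite +-suc j n = refl

col-range : ∀ n j → 1 ≤ n → 1 ≤ col n j × col n j ≤ n
col-range (suc n) j _ = s≤s z≤n , m%n<n (j + suc n ∸ 1) (suc n)

col-zero : ∀ n → col n 0 ≡ n
col-zero zero = refl
col-zero (suc n) = trans (sym (col-+ (suc n) 0)) (col-id (suc n) (suc n) (s≤s z≤n) ≤-refl)

∸-from-+ : ∀ a b c → a ≡ b + c → a ∸ b ≡ c
∸-from-+ a b c eq = trans (cong (_∸ b) eq) (m+n∸m≡n b c)

≤-split : ∀ {a b} → a ≤ b → ∃ λ r → b ≡ a + r
≤-split a≤b = let (r , eq) = m≤n⇒∃[o]m+o≡n a≤b in r , sym eq

module Mirror (K : ℕ) (1≤K : 1 ≤ K) where

  n : ℕ
  n = K + K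

  1≤n : 1 ≤ n
  1≤n = ≤-trans 1≤K (m≤m+n K K)

  mirror : ℕ → ℕ
  mirror c = suc n ∸ c

  pairIndex : ℕ → ℕ
  pairIndex c = c ⊓ mirror c

  K<mirror : ∀ q → q ≤ K → K < mirror q
  K<mirror q q≤K = begin-strict
      K               <⟨ n<1+n K ⟩
      suc K           ≡⟨ m+n∸n≡m (suc K) K ⟨
      suc K + K ∸ K   ≤⟨ ∸-monoʳ-≤ (suc K + K) q≤K ⟩
      mirror q        ∎
    where open ≤-Reasoning

  q≤K⇒q≤1+n : ∀ {q} → q ≤ K → q ≤ suc n
  q≤K⇒q≤1+n q≤K = ≤-trans q≤K (≤-trans (m≤m+n K K) (n≤1+n n))

  mirror-involutive : ∀ c → c ≤ suc n → mirror (mirror c) ≡ c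
  mirror-involutive c = m∸[m∸n]≡n

  pairIndex-low : ∀ q → q ≤ K → pairIndex q ≡ q
  pairIndex-low q q≤K = m≤n⇒m⊓n≡m (≤-trans q≤K (<⇒≤ (K<mirror q q≤K)))

  pairIndex-mirror-low : ∀ q → q ≤ K → pairIndex (mirror q) ≡ q
  pairIndex-mirror-low q q≤K =
    trans (cong (mirror q ⊓_) (mirror-involutive q (q≤K⇒q≤1+n q≤K)))
          (m≥n⇒m⊓n≡n (≤-trans q≤K (<⇒≤ (K<mirror q q≤K))))

  isOdd-mirror : ∀ c → c ≤ suc n → isOdd (mirror c) ≡ not (isOdd c)
  isOdd-mirror c c≤ = xor-true (isOdd (mirror c)) (isOdd c) sum-odd
    where
    sum-odd : isOdd (mirror c) xor isOdd c ≡ true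
    sum-odd = trans (sym (isOdd-+ (mirror c) c))
                (trans (cong isOdd (m∸n+n≡m c≤)) (cong not (isOdd-double K)))
    xor-true : ∀ x y → x xor y ≡ true → x ≡ not y
    xor-true true false _ = refl
    xor-true false true _ = refl

  low-range : ∀ q → 1 ≤ q → q ≤ K → 1 ≤ q × q ≤ n
  low-range q 1≤q q≤K = 1≤q , ≤-trans q≤K (m≤m+n K K)

  mirror-range : ∀ c → 1 ≤ c → c ≤ n → 1 ≤ mirror c × mirror c ≤ n
  mirror-range c 1≤c c≤n = m<n⇒0<n∸m (s≤s c≤n) , ∸-monoʳ-≤ (suc n) 1≤c

  low-or-mirror : ∀ c → 1 ≤ c → c ≤ n → ∃ λ q → (1 ≤ q × q ≤ K) × (c ≡ q ⊎ c ≡ mirror q)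
  low-or-mirror c 1≤c c≤n with c ≤? K
  ... | yes c≤K = c , (1≤c , c≤K) , inj₁ refl
  ... | no c≰K = mirror c , (proj₁ (mirror-range c 1≤c c≤n) , mirror-c≤K) ,
                 inj₂ (sym (mirror-involutive c (≤-trans c≤n (n≤1+n n))))
    where
    mirror-c≤K : mirror c ≤ K
    mirror-c≤K = begin
        suc n ∸ c       ≤⟨ ∸-monoʳ-≤ (suc n) (≰⇒> c≰K) ⟩
        suc n ∸ suc K   ≡⟨ m+n∸m≡n K K ⟩
        K               ∎
      where open ≤-Reasoning

  pairIndex-range : ∀ c → 1 ≤ c → c ≤ n → 1 ≤ pairIndex c × pairIndex c ≤ K
  pairIndex-range c 1≤c c≤n with low-or-mirror c 1≤c c≤n
  ... | q , q-range , inj₁ refl = subst (λ x → 1 ≤ x × x ≤ K) (sym (pairIndex-low q (proj₂ q-range))) q-range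
  ... | q , q-range , inj₂ refl = subst (λ x → 1 ≤ x × x ≤ K) (sym (pairIndex-mirror-low q (proj₂ q-range))) q-range

  pairIndex-mirror : ∀ c → 1 ≤ c → c ≤ n → pairIndex (mirror c) ≡ pairIndex c
  pairIndex-mirror c 1≤c c≤n with low-or-mirror c 1≤c c≤n
  ... | q , (_ , q≤K) , inj₁ refl = trans (pairIndex-mirror-low q q≤K) (sym (pairIndex-low q q≤K))
  ... | q , (_ , q≤K) , inj₂ refl =
    trans (cong pairIndex (mirror-involutive q (q≤K⇒q≤1+n q≤K)))
          (trans (pairIndex-low q q≤K) (sym (pairIndex-mirror-low q q≤K)))

  pairIndex-isOdd-injective : ∀ c e → 1 ≤ c → c ≤ n → 1 ≤ e → e ≤ n →
    pairIndex c ≡ pairIndex e → isOdd c ≡ isOdd e → c ≡ e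
  pairIndex-isOdd-injective c e 1≤c c≤n 1≤e e≤n eq oeq
    with low-or-mirror c 1≤c c≤n | low-or-mirror e 1≤e e≤n
  ... | q , (_ , q≤K) , inj₁ refl | q' , (_ , q'≤K) , inj₁ refl =
    trans (sym (pairIndex-low q q≤K)) (trans eq (pairIndex-low q' q'≤K))
  ... | q , (_ , q≤K) , inj₂ refl | q' , (_ , q'≤K) , inj₂ refl =
    cong mirror (trans (sym (pairIndex-mirror-low q q≤K)) (trans eq (pairIndex-mirror-low q' q'≤K)))
  ... | q , (_ , q≤K) , inj₁ refl | q' , (_ , q'≤K) , inj₂ refl =
    ⊥-elim (not-¬ refl (trans oeq (trans (isOdd-mirror q' (q≤K⇒q≤1+n q'≤K)) (cong (λ x → not (isOdd x)) (sym q≡q')))))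
    where
    q≡q' : q ≡ q'
    q≡q' = trans (sym (pairIndex-low q q≤K)) (trans eq (pairIndex-mirror-low q' q'≤K))
  ... | q , (_ , q≤K) , inj₂ refl | q' , (_ , q'≤K) , inj₁ refl =
    ⊥-elim (not-¬ refl (trans (sym oeq) (trans (isOdd-mirror q (q≤K⇒q≤1+n q≤K)) (cong (λ x → not (isOdd x)) q≡q'))))
    where
    q≡q' : q ≡ q'
    q≡q' = trans (sym (pairIndex-mirror-low q q≤K)) (trans eq (pairIndex-low q' q'≤K))

  pairIndex-isOdd-surjective : ∀ q b → 1 ≤ q → q ≤ K →
    ∃ λ c → (1 ≤ c × c ≤ n) × pairIndex c ≡ q × isOdd c ≡ b
  pairIndex-isOdd-surjective q b 1≤q q≤K with isOdd q Bool.≟ b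
  ... | yes eq = q , low-range q 1≤q q≤K , pairIndex-low q q≤K , eq
  ... | no neq = mirror q , mirror-range q 1≤q (proj₂ (low-range q 1≤q q≤K)) , pairIndex-mirror-low q q≤K ,
                 trans (isOdd-mirror q (q≤K⇒q≤1+n q≤K)) (trans (cong not (Bool.¬-not neq)) (not-involutive b))

  next : ℕ → ℕ
  next c = col n (suc c)

  next-range : ∀ c → 1 ≤ next c × next c ≤ n
  next-range c = col-range n (suc c) 1≤n

  isOdd-next : ∀ c → 1 ≤ c → c ≤ n → isOdd (next c) ≡ not (isOdd c)
  isOdd-next c 1≤c c≤n with m≤n⇒m<n∨m≡n c≤n
  ... | inj₁ c<n rewrite col-id n (suc c) (s≤s z≤n) c<n = refl
  ... | inj₂ refl rewrite col-+ n 1 | col-id n 1 ≤-refl 1≤n = sym (cong not (isOdd-double K))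

  col-∸-next : ∀ c → 1 ≤ c → c ≤ n → col n (n ∸ c) ≡ mirror (next c)
  col-∸-next c 1≤c c≤n with m≤n⇒m<n∨m≡n c≤n
  ... | inj₁ c<n rewrite col-id n (suc c) (s≤s z≤n) c<n = col-id n (n ∸ c) (m<n⇒0<n∸m c<n) (m∸n≤m n c)
  ... | inj₂ refl rewrite col-+ n 1 | col-id n 1 ≤-refl 1≤n | n∸n≡0 n = col-zero n

  col-flip : ∀ c → 1 ≤ c → c ≤ n → col n (n + 1 ∸ c) ≡ mirror c
  col-flip c 1≤c c≤n rewrite +-comm n 1 =
    col-id n (mirror c) (proj₁ (mirror-range c 1≤c c≤n)) (proj₂ (mirror-range c 1≤c c≤n))

  n/2≡K : n / 2 ≡ K
  n/2≡K = double/2 K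

  n₀≡K∸1 : n₀ n ≡ K ∸ 1
  n₀≡K∸1 = cong (_∸ 1) n/2≡K

  ≤n₀⇒<K : ∀ {j} → j ≤ n₀ n → j < K
  ≤n₀⇒<K {j} j≤ = ≤∸1⇒< 1≤K (subst (j ≤_) n₀≡K∸1 j≤)

  <K⇒≤n₀ : ∀ {j} → j < K → j ≤ n₀ n
  <K⇒≤n₀ {j} (s≤s j≤) = subst (j ≤_) (sym n₀≡K∸1) j≤

  ≤1+n₀⇒∸1<K : ∀ j → j ≤ suc (n₀ n) → j ∸ 1 < K
  ≤1+n₀⇒∸1<K zero _ = 1≤K
  ≤1+n₀⇒∸1<K (suc j) (s≤s j≤) = ≤n₀⇒<K j≤

-- The vertices of G

UPair-swap : ∀ {u v p q} → UPair u v p q → UPair u v q p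
UPair-swap (inj₁ (a , b)) = inj₂ (a , b)
UPair-swap (inj₂ (a , b)) = inj₁ (a , b)

UPair-subst : ∀ {u v p q p' q'} → p ≡ p' → q ≡ q' → UPair u v p q → UPair u v p' q'
UPair-subst refl refl h = h

GEdge-sym : ∀ {N k a u v} → GEdge N k a u v → GEdge N k a v u
GEdge-sym (u-vertex , v-vertex , u≢v , z₁ , z₂ , j , p₁ , p₂ , 1≤j , j≤k , sum) =
  v-vertex , u-vertex , (λ e → u≢v (sym e)) , z₂ , z₁ , j , p₂ , p₁ , 1≤j , j≤k , trans (+-comm z₂ z₁) sum

-- encode N s x is the element of the vertex {x + 1, N − x} of G selected by s.
encode : ℕ → Bool → ℕ → ℕ
encode N false x = suc x
encode N true x = N ∸ x

encode-reflect : ∀ N s A x → suc (A + x) ≤ N → encode N s A ≡ encode N (not s) (N ∸ suc (A + x) + x)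
encode-reflect N false A x p with ≤-split p
... | R , refl = sym (trans (cong (λ z → suc (A + x) + R ∸ (z + x)) (m+n∸m≡n (suc (A + x)) R))
                       (∸-from-+ _ (R + x) (suc A) (regroup A x R)))
  where
  regroup : ∀ A x R → suc (A + x) + R ≡ R + x + suc A
  regroup = solve-∀
encode-reflect N true A x p with ≤-split p
... | R , refl = trans (∸-from-+ _ A (suc (x + R)) (regroup A x R))
                   (cong suc (trans (+-comm x R) (cong (_+ x) (sym (m+n∸m≡n (suc (A + x)) R)))))
  where
  regroup : ∀ A x R → suc (A + x) + R ≡ A + suc (x + R)
  regroup = solve-∀

balanced-sum : ∀ N a b c e → a + e ≡ b + c → b ≤ N → c ≤ N →
  suc a + (N ∸ b) + (N ∸ c) + suc e ≡ suc N + suc N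
balanced-sum N a b c e h b≤N c≤N with ≤-split b≤N | ≤-split c≤N
... | R₁ , refl | R₂ , eq₂ = begin
    suc a + (b + R₁ ∸ b) + (b + R₁ ∸ c) + suc e
  ≡⟨ cong₂ (λ u v → suc a + u + v + suc e) (m+n∸m≡n b R₁) (∸-from-+ _ c R₂ eq₂) ⟩
    suc a + R₁ + R₂ + suc e
  ≡⟨ regroup₁ a R₁ R₂ e ⟩
    suc (suc (a + e + R₁ + R₂))
  ≡⟨ cong (λ z → suc (suc (z + R₁ + R₂))) h ⟩
    suc (suc (b + c + R₁ + R₂))
  ≡⟨ regroup₂ b c R₁ R₂ ⟩
    suc (b + R₁) + suc (c + R₂)
  ≡⟨ cong (λ z → suc (b + R₁) + suc z) (sym eq₂) ⟩
    suc (b + R₁) + suc (b + R₁) ∎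
  where
  open ≡-Reasoning
  regroup₁ : ∀ a R₁ R₂ e → suc a + R₁ + R₂ + suc e ≡ suc (suc (a + e + R₁ + R₂))
  regroup₁ = solve-∀
  regroup₂ : ∀ b c R₁ R₂ → suc (suc (b + c + R₁ + R₂)) ≡ suc (b + R₁) + suc (c + R₂)
  regroup₂ = solve-∀

encode-face-sum : ∀ N e P Q D D' → P + D ≤ N → P + D' ≤ N → Q + D ≤ N → Q + D' ≤ N →
  encode N e (P + D) + encode N (not e) (P + D') + encode N (not e) (Q + D) + encode N e (Q + D')
    ≡ suc N + suc N
encode-face-sum N false P Q D D' _ p₂ p₃ _ =
  balanced-sum N (P + D) (P + D') (Q + D) (Q + D') (balanced P Q D D') p₂ p₃
  where
  balanced : ∀ P Q D D' → P + D + (Q + D') ≡ P + D' + (Q + D)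
  balanced = solve-∀
encode-face-sum N true P Q D D' p₁ _ _ p₄ =
  trans (rearrange (N ∸ (P + D)) (P + D') (Q + D) (N ∸ (Q + D')))
        (balanced-sum N (P + D') (P + D) (Q + D') (Q + D) (balanced P Q D D') p₁ p₄)
  where
  rearrange : ∀ x b c y → x + suc b + suc c + y ≡ suc b + x + y + suc c
  rearrange = solve-∀
  balanced : ∀ P Q D D' → P + D' + (Q + D) ≡ P + D + (Q + D')
  balanced = solve-∀

encode-step-down : ∀ N G d → G + d ≤ N → encode N false G + encode N true (G + d) ≡ suc N ∸ d
encode-step-down N G d p with ≤-split p
... | R , refl = sym (∸-from-+ _ d (suc G + (G + d + R ∸ (G + d)))
                   (trans (regroup G d R) (cong (λ z → d + (suc G + z)) (sym (m+n∸m≡n (G + d) R)))))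
  where
  regroup : ∀ G d R → suc (G + d + R) ≡ d + (suc G + R)
  regroup = solve-∀

encode-step-up : ∀ N G d → G ≤ N → encode N true G + encode N false (G + d) ≡ suc N + d
encode-step-up N G d p with ≤-split p
... | R , refl = trans (cong (_+ suc (G + d)) (m+n∸m≡n G R)) (regroup G d R)
  where
  regroup : ∀ G d R → R + suc (G + d) ≡ suc (G + R) + d
  regroup = solve-∀

vtx-cases : ∀ N x → vtx N x ≡ x ⊎ vtx N x ≡ suc N ∸ x
vtx-cases N x rewrite +-comm N 1 = ⊓-sel x (suc N ∸ x)

vtx-complement : ∀ N x → x ≤ suc N → vtx N (suc N ∸ x) ≡ vtx N x
vtx-complement N x x≤ rewrite +-comm N 1 =
  trans (cong ((suc N ∸ x) ⊓_) (m∸[m∸n]≡n x≤)) (⊓-comm (suc N ∸ x) x)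

complement-swap : ∀ N x y → y ≤ suc N → x ≡ suc N ∸ y → y ≡ suc N ∸ x
complement-swap N x y y≤ refl = sym (m∸[m∸n]≡n y≤)

vtx-injective : ∀ N x y → x ≤ suc N → y ≤ suc N → vtx N x ≡ vtx N y → x ≡ y ⊎ x ≡ suc N ∸ y
vtx-injective N x y x≤ y≤ e with vtx-cases N x | vtx-cases N y
... | inj₁ a | inj₁ b = inj₁ (trans (sym a) (trans e b))
... | inj₁ a | inj₂ b = inj₂ (trans (sym a) (trans e b))
... | inj₂ a | inj₁ b = inj₂ (complement-swap N y x x≤ (trans (sym b) (trans (sym e) a)))
... | inj₂ a | inj₂ b = inj₁ (∸-cancelˡ-≡ x≤ y≤ (trans (sym a) (trans e b)))

∈-vtx : ∀ N x → x ≤ suc N → x ≡ vtx N x ⊎ x ≡ N + 1 ∸ vtx N x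
∈-vtx N x x≤ with vtx-cases N x
... | inj₁ e = inj₁ (sym e)
... | inj₂ e = inj₂ (trans (complement-swap N (vtx N x) x x≤ e) (cong (_∸ vtx N x) (+-comm 1 N)))

vtx-isVertex : ∀ h x → 1 ≤ x → x ≤ h + h → IsVertex (h + h) (vtx (h + h) x)
vtx-isVertex h x 1≤x x≤ rewrite double/2 h = lower , upper
  where
  lower : 1 ≤ vtx (h + h) x
  lower with vtx-cases (h + h) x
  ... | inj₁ e = subst (1 ≤_) (sym e) 1≤x
  ... | inj₂ e = subst (1 ≤_) (sym e) (m<n⇒0<n∸m (s≤s x≤))
  upper : vtx (h + h) x ≤ h
  upper with x ≤? h
  ... | yes x≤h = ≤-trans (m⊓n≤m x _) x≤h
  ... | no x≰h = ≤-trans (m⊓n≤n x (h + h + 1 ∸ x)) (begin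
      h + h + 1 ∸ x     ≡⟨ cong (_∸ x) (+-comm (h + h) 1) ⟩
      suc (h + h) ∸ x   ≤⟨ ∸-monoʳ-≤ (suc (h + h)) (≰⇒> x≰h) ⟩
      h + h ∸ h         ≡⟨ m+n∸m≡n h h ⟩
      h                 ∎)
    where open ≤-Reasoning

vtx-vertex : ∀ h u → IsVertex (h + h) u → vtx (h + h) u ≡ u
vtx-vertex h u (_ , u≤) = m≤n⇒m⊓n≡m (begin
    u               ≡⟨ m+n∸m≡n u u ⟨
    u + u ∸ u       ≤⟨ ∸-monoˡ-≤ u (+-mono-≤ u≤h u≤h) ⟩
    h + h ∸ u       ≤⟨ ∸-monoˡ-≤ u (m≤m+n (h + h) 1) ⟩
    h + h + 1 ∸ u   ∎)
  where
  open ≤-Reasoning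
  u≤h : u ≤ h
  u≤h = subst (u ≤_) (double/2 h) u≤

-- Labelings from a splitting of the vertices of G

-- A splitting of the vertices of G into m arithmetic progressions of length K.
record LabelScheme (m K : ℕ) : Set where
  field
    step : ℕ
    base : ℕ → ℕ → ℕ
    base-linear : ∀ t l → base t l ≡ base t 0 + step * l
    base-< : ∀ t l → t < m → l < K → base t l < m * (K + K)
    value-injective : ∀ t l s t' l' s' → t < m → l < K → t' < m → l' < K →
      encode (m * (K + K)) s (base t l) ≡ encode (m * (K + K)) s' (base t' l') →
      t ≡ t' × l ≡ l' × s ≡ s'
    value-surjective : ∀ y → 1 ≤ y → y ≤ m * (K + K) →
      ∃[ t ] ∃[ l ] ∃[ s ] (t < m × l < K × encode (m * (K + K)) s (base t l) ≡ y)

-- Row i of the labeling walks along progression (row i), backwards if (reversed i).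
record RowAssignment (m : ℕ) : Set where
  field
    row : ℕ → ℕ
    rowOf : ℕ → ℕ
    reversed : ℕ → Bool
    row-< : ∀ i → 1 ≤ i → i ≤ m → row i < m
    rowOf-range : ∀ t → t < m → 1 ≤ rowOf t × rowOf t ≤ m
    row-rowOf : ∀ t → t < m → row (rowOf t) ≡ t
    rowOf-row : ∀ i → 1 ≤ i → i ≤ m → rowOf (row i) ≡ i

module SchemeLabeling {m K : ℕ} (1≤K : 1 ≤ K) (m-odd : isOdd m ≡ true) (S : LabelScheme m K) where

  open Mirror K 1≤K public
  open LabelScheme S public

  N : ℕ
  N = m * n

  1≤m : 1 ≤ m
  1≤m = isOdd⇒1≤ m m-odd

  value : ℕ → ℕ → Bool → ℕ
  value t l s = encode N s (base t l)

  value-range : ∀ t l s → t < m → l < K → 1 ≤ value t l s × value t l s ≤ N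
  value-range t l false t<m l<K = s≤s z≤n , base-< t l t<m l<K
  value-range t l true t<m l<K = m<n⇒0<n∸m (base-< t l t<m l<K) , m∸n≤m N (base t l)

  position : Bool → ℕ → ℕ
  position false q = q ∸ 1
  position true q = K ∸ q

  position-< : ∀ b q → 1 ≤ q → q ≤ K → position b q < K
  position-< false (suc q) _ q<K = q<K
  position-< true q 1≤q q≤K = ≤-trans (s≤s (∸-monoʳ-≤ K 1≤q)) (≤-reflexive (sym (+-∸-assoc 1 1≤K)))

  position-injective : ∀ b q q' → q ≤ K → q' ≤ K → 1 ≤ q → 1 ≤ q' → position b q ≡ position b q' → q ≡ q'
  position-injective false (suc q) (suc q') _ _ _ _ e = cong suc e
  position-injective true q q' q≤K q'≤K _ _ e = ∸-cancelˡ-≡ q≤K q'≤K e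

  position-surjective : ∀ b l → l < K → ∃ λ q → (1 ≤ q × q ≤ K) × position b q ≡ l
  position-surjective false l l<K = suc l , (s≤s z≤n , l<K) , refl
  position-surjective true l l<K = K ∸ l , (m<n⇒0<n∸m l<K , m∸n≤m K l) , m∸[m∸n]≡n (<⇒≤ l<K)

  base-split : ∀ t q → 1 ≤ q → q ≤ K → base t (K ∸ 1) ≡ base t (K ∸ q) + step * (q ∸ 1)
  base-split t (suc q) _ q<K with ≤-split q<K
  ... | R , K≡ = begin
      base t (K ∸ 1)                          ≡⟨ base-linear t (K ∸ 1) ⟩
      base t 0 + step * (K ∸ 1)               ≡⟨ cong (λ z → base t 0 + step * z) K∸1≡ ⟩
      base t 0 + step * (K ∸ suc q + q)       ≡⟨ distrib (base t 0) step (K ∸ suc q) q ⟩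
      base t 0 + step * (K ∸ suc q) + step * q ≡⟨ cong (_+ step * q) (sym (base-linear t (K ∸ suc q))) ⟩
      base t (K ∸ suc q) + step * q           ∎
    where
    open ≡-Reasoning
    K∸1≡ : K ∸ 1 ≡ K ∸ suc q + q
    K∸1≡ rewrite K≡ = trans (+-comm q R) (cong (_+ q) (sym (m+n∸m≡n (suc q) R)))
    distrib : ∀ a d x y → a + d * (x + y) ≡ a + d * x + d * y
    distrib = solve-∀

  -- Reading a row backwards exchanges x + 1 and N − x, so it is again a progression, starting here.
  start : Bool → ℕ → ℕ
  start false t = base t 0
  start true t = N ∸ suc (base t (K ∸ 1))

  value-position : ∀ b t q e → t < m → 1 ≤ q → q ≤ K →
    value t (position b q) (e xor b) ≡ encode N e (start b t + step * (q ∸ 1))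
  value-position false t q e _ _ _ = cong₂ (encode N) (Bool.xor-identityʳ e) (base-linear t (q ∸ 1))
  value-position true t q e t<m 1≤q q≤K = begin
      encode N (e xor true) (base t (K ∸ q))
    ≡⟨ encode-reflect N (e xor true) (base t (K ∸ q)) (step * (q ∸ 1)) bound ⟩
      encode N (not (e xor true)) (N ∸ suc (base t (K ∸ q) + step * (q ∸ 1)) + step * (q ∸ 1))
    ≡⟨ cong₂ (λ s x → encode N s (N ∸ suc x + step * (q ∸ 1)))
             (trans (not-distribʳ-xor e true) (Bool.xor-identityʳ e)) (sym (base-split t q 1≤q q≤K)) ⟩
      encode N e (N ∸ suc (base t (K ∸ 1)) + step * (q ∸ 1))
    ∎
    where
    open ≡-Reasoning
    bound : suc (base t (K ∸ q) + step * (q ∸ 1)) ≤ N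
    bound = subst (λ z → suc z ≤ N) (base-split t q 1≤q q≤K) (base-< t (K ∸ 1) t<m (position-< true 1 ≤-refl 1≤K))

  start-bound : ∀ b t q → t < m → 1 ≤ q → q ≤ K → start b t + step * (q ∸ 1) ≤ N
  start-bound false t q t<m 1≤q q≤K =
    subst (_≤ N) (base-linear t (q ∸ 1)) (<⇒≤ (base-< t (q ∸ 1) t<m (position-< false q 1≤q q≤K)))
  start-bound true t q t<m 1≤q q≤K = begin
      N ∸ suc top + step * (q ∸ 1)   ≤⟨ +-monoʳ-≤ (N ∸ suc top) step≤ ⟩
      N ∸ suc top + suc top          ≡⟨ m∸n+n≡m (base-< t (K ∸ 1) t<m (position-< true 1 ≤-refl 1≤K)) ⟩
      N                              ∎
    where
    open ≤-Reasoning
    top : ℕ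
    top = base t (K ∸ 1)
    step≤ : step * (q ∸ 1) ≤ suc top
    step≤ = ≤-trans (m≤n+m (step * (q ∸ 1)) (base t (K ∸ q)))
              (≤-trans (≤-reflexive (sym (base-split t q 1≤q q≤K))) (n≤1+n _))

  N≡ : N ≡ m * K + m * K
  N≡ = *-distribˡ-+ m K K

  value-≤1+N : ∀ t l s → t < m → l < K → value t l s ≤ suc N
  value-≤1+N t l s t<m l<K = ≤-trans (proj₂ (value-range t l s t<m l<K)) (n≤1+n N)

  vertexOf : ℕ → ℕ → ℕ
  vertexOf t l = vtx N (value t l false)

  vtx-value : ∀ t l s → t < m → l < K → vtx N (value t l s) ≡ vertexOf t l
  vtx-value t l false _ _ = refl
  vtx-value t l true t<m l<K = vtx-complement N (value t l false) (value-≤1+N t l false t<m l<K)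

  vertexOf-injective : ∀ t l t' l' → t < m → l < K → t' < m → l' < K →
    vertexOf t l ≡ vertexOf t' l' → t ≡ t' × l ≡ l'
  vertexOf-injective t l t' l' t<m l<K t'<m l'<K e
    with vtx-injective N _ _ (value-≤1+N t l false t<m l<K) (value-≤1+N t' l' false t'<m l'<K) e
  ... | inj₁ x = let (p , q , _) = value-injective t l false t' l' false t<m l<K t'<m l'<K x in p , q
  ... | inj₂ x = let (p , q , _) = value-injective t l false t' l' true t<m l<K t'<m l'<K x in p , q

  vertexOf-isVertex : ∀ t l → t < m → l < K → IsVertex N (vertexOf t l)
  vertexOf-isVertex t l t<m l<K =
    subst (λ M → IsVertex M (vtx M (value t l false))) (sym N≡)
      (vtx-isVertex (m * K) (value t l false) (s≤s z≤n)
        (subst (value t l false ≤_) N≡ (proj₂ (value-range t l false t<m l<K))))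

  value-∈-vertexOf : ∀ t l s → t < m → l < K → value t l s ≡ vertexOf t l ⊎ value t l s ≡ N + 1 ∸ vertexOf t l
  value-∈-vertexOf t l s t<m l<K rewrite sym (vtx-value t l s t<m l<K) = ∈-vtx N (value t l s) (value-≤1+N t l s t<m l<K)

  pathSum : Bool → ℕ
  pathSum true = suc N ∸ step
  pathSum false = suc N + step

  path : ℕ → ℕ → ℕ
  path i j = vertexOf (i ∸ 1) (j ∸ 1)

  pathEntry : ℕ → ℕ → ℕ
  pathEntry t j = value t (j ∸ 1) (not (isOdd j))

  pathEntry-∈ : ∀ t j → t < m → 1 ≤ j → j ≤ K →
    pathEntry t j ≡ path (suc t) j ⊎ pathEntry t j ≡ N + 1 ∸ path (suc t) j
  pathEntry-∈ t (suc j) t<m _ j<K = value-∈-vertexOf t j (not (isOdd (suc j))) t<m j<K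

  base-suc : ∀ t l → base t (suc l) ≡ base t l + step
  base-suc t l = trans (base-linear t (suc l)) (trans (regroup (base t 0) step l) (cong (_+ step) (sym (base-linear t l))))
    where
    regroup : ∀ a d l → a + d * suc l ≡ a + d * l + d
    regroup = solve-∀

  pathEntry-sum : ∀ t j → t < m → 1 ≤ j → j < K → pathEntry t j + pathEntry t (suc j) ≡ pathSum (isOdd j)
  pathEntry-sum t (suc j) t<m _ j<K with isOdd j
  ... | false rewrite base-suc t j =
    encode-step-down N (base t j) step (subst (_≤ N) (base-suc t j) (<⇒≤ (base-< t (suc j) t<m j<K)))
  ... | true rewrite base-suc t j =
    encode-step-up N (base t j) step (<⇒≤ (base-< t j t<m (<-trans (n<1+n j) j<K)))

  pathGraph : Graph
  pathGraph u v = ∃[ i ] ∃[ j ] (1 ≤ i × i ≤ m × 1 ≤ j × j ≤ n₀ n × UPair u v (path i j) (path i (suc j)))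

  module PathPartition (a : ℕ → ℕ) (a≡pathSum : ∀ j → 1 ≤ j → j < K → a j ≡ pathSum (isOdd j)) where

    path-step-edge : ∀ t j → t < m → 1 ≤ j → j ≤ n₀ n → GEdge N (n₀ n) a (path (suc t) j) (path (suc t) (suc j))
    path-step-edge t (suc j) t<m _ j≤ =
      vertexOf-isVertex t j t<m j<K , vertexOf-isVertex t (suc j) t<m 1+j<K ,
      (λ e → 1+n≢n (sym (proj₂ (vertexOf-injective t j t (suc j) t<m j<K t<m 1+j<K e)))) ,
      pathEntry t (suc j) , pathEntry t (suc (suc j)) , suc j ,
      pathEntry-∈ t (suc j) t<m (s≤s z≤n) (<⇒≤ 1+j<K) , pathEntry-∈ t (suc (suc j)) t<m (s≤s z≤n) 1+j<K ,
      s≤s z≤n , j≤ , trans (pathEntry-sum t (suc j) t<m (s≤s z≤n) 1+j<K) (sym (a≡pathSum (suc j) (s≤s z≤n) 1+j<K))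
      where
      1+j<K : suc j < K
      1+j<K = ≤n₀⇒<K j≤
      j<K : j < K
      j<K = <-trans (n<1+n j) 1+j<K

    pathGraph⊆G : ∀ u v → pathGraph u v → GEdge (m * n) (n₀ n) a u v
    pathGraph⊆G u v (suc t , j , _ , t<m , 1≤j , j≤ , inj₁ (refl , refl)) = path-step-edge t j t<m 1≤j j≤
    pathGraph⊆G u v (suc t , j , _ , t<m , 1≤j , j≤ , inj₂ (refl , refl)) = GEdge-sym (path-step-edge t j t<m 1≤j j≤)

    path-admissible : ∀ i → 1 ≤ i → i ≤ m → AdmissiblePath (m * n) (n₀ n) a (path i)
    path-admissible (suc t) _ t<m =
      (λ j _ j≤ → vertexOf-isVertex t (j ∸ 1) t<m (≤1+n₀⇒∸1<K j j≤)) ,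
      (λ { (suc j) (suc j') _ j≤ _ j'≤ e →
           cong suc (proj₂ (vertexOf-injective t j t j' t<m (≤1+n₀⇒∸1<K (suc j) j≤)
                                                t<m (≤1+n₀⇒∸1<K (suc j') j'≤) e)) }) ,
      pathEntry t ,
      (λ { (suc j) 1≤j j≤ → pathEntry-∈ t (suc j) t<m 1≤j (≤1+n₀⇒∸1<K (suc j) j≤) }) ,
      (λ j 1≤j j≤ → trans (pathEntry-sum t j t<m 1≤j (≤n₀⇒<K j≤)) (sym (a≡pathSum j 1≤j (≤n₀⇒<K j≤))))

    paths-disjoint : ∀ i i' j j' → 1 ≤ i → i ≤ m → 1 ≤ i' → i' ≤ m →
      1 ≤ j → j ≤ suc (n₀ n) → 1 ≤ j' → j' ≤ suc (n₀ n) → path i j ≡ path i' j' → i ≡ i'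
    paths-disjoint (suc t) (suc t') j j' _ t<m _ t'<m _ j≤ _ j'≤ e =
      cong suc (proj₁ (vertexOf-injective t (j ∸ 1) t' (j' ∸ 1) t<m (≤1+n₀⇒∸1<K j j≤)
                                          t'<m (≤1+n₀⇒∸1<K j' j'≤) e))

    paths-cover : ∀ u → IsVertex (m * n) u →
      ∃[ i ] ∃[ j ] (1 ≤ i × i ≤ m × 1 ≤ j × j ≤ suc (n₀ n) × path i j ≡ u)
    paths-cover u u-vertex@(1≤u , u≤) with value-surjective u 1≤u u≤N
      where
      u≤N : u ≤ N
      u≤N = ≤-trans u≤ (≤-trans (≤-reflexive (trans (cong (_/ 2) N≡) (double/2 (m * K))))
                               (≤-trans (m≤m+n (m * K) (m * K)) (≤-reflexive (sym N≡))))
    ... | t , l , s , t<m , l<K , value≡u =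
      suc t , suc l , s≤s z≤n , t<m , s≤s z≤n , s≤s (<K⇒≤n₀ l<K) ,
      trans (sym (vtx-value t l s t<m l<K))
            (trans (cong (vtx N) value≡u)
                   (subst (λ M → vtx M u ≡ u) (sym N≡) (vtx-vertex (m * K) u (subst (λ M → IsVertex M u) N≡ u-vertex))))

    pathPartition : AdmissiblePathPartition m n a pathGraph
    pathPartition =
      pathGraph⊆G , path , path-admissible , paths-disjoint , paths-cover , (λ u v → mk⇔ (λ x → x) (λ x → x))

  module LabelingFor (R : RowAssignment m) where

    open RowAssignment R public

    labeling : Labeling
    labeling i c = value (row i) (position (reversed i) (pairIndex c)) (isOdd (i + c) xor reversed i)

    position-pairIndex-< : ∀ i c → 1 ≤ c → c ≤ n → position (reversed i) (pairIndex c) < K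
    position-pairIndex-< i c 1≤c c≤n =
      position-< (reversed i) (pairIndex c) (proj₁ (pairIndex-range c 1≤c c≤n)) (proj₂ (pairIndex-range c 1≤c c≤n))

    labeling-injective : ∀ i j i' j' → InRange m n i j → InRange m n i' j' →
      labeling i j ≡ labeling i' j' → i ≡ i' × j ≡ j'
    labeling-injective i j i' j' (a , b , c , e) (a' , b' , c' , e') eq
      with value-injective _ _ _ _ _ _ (row-< i a b) (position-pairIndex-< i j c e)
                                       (row-< i' a' b') (position-pairIndex-< i' j' c' e') eq
    ... | same-row , same-position , same-sign = i≡i' , j≡j'
      where
      i≡i' : i ≡ i'
      i≡i' = trans (sym (rowOf-row i a b)) (trans (cong rowOf same-row) (rowOf-row i' a' b'))
      same-sign' : isOdd (i + j) xor reversed i ≡ isOdd (i + j') xor reversed i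
      same-sign' = trans same-sign (cong (λ z → isOdd (z + j') xor reversed z) (sym i≡i'))
      same-parity : isOdd j ≡ isOdd j'
      same-parity = xor-cancelˡ (isOdd i) (isOdd j) (isOdd j')
        (trans (sym (isOdd-+ i j)) (trans (xor-cancelʳ _ _ (reversed i) same-sign') (isOdd-+ i j')))
      same-pairIndex : pairIndex j ≡ pairIndex j'
      same-pairIndex = position-injective (reversed i) (pairIndex j) (pairIndex j')
        (proj₂ (pairIndex-range j c e)) (proj₂ (pairIndex-range j' c' e'))
        (proj₁ (pairIndex-range j c e)) (proj₁ (pairIndex-range j' c' e'))
        (trans same-position (cong (λ z → position (reversed z) (pairIndex j')) (sym i≡i')))
      j≡j' : j ≡ j'
      j≡j' = pairIndex-isOdd-injective j j' c e c' e' same-pairIndex same-parity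

    labeling-surjective : ∀ v → 1 ≤ v → v ≤ N → ∃[ i ] ∃[ j ] (InRange m n i j × labeling i j ≡ v)
    labeling-surjective v 1≤v v≤N with value-surjective v 1≤v v≤N
    ... | t , l , s , t<m , l<K , value≡v with rowOf-range t t<m
    ... | i-range with position-surjective (reversed (rowOf t)) l l<K
    ... | q , (1≤q , q≤K) , position≡l
      with pairIndex-isOdd-surjective q ((isOdd (rowOf t) xor reversed (rowOf t)) xor s) 1≤q q≤K
    ... | c , c-range , pairIndex≡q , parity =
      i , c , (proj₁ i-range , proj₂ i-range , c-range) ,
      trans (cong₂ (λ r x → value r x (isOdd (i + c) xor reversed i))
                   (row-rowOf t t<m) (trans (cong (position (reversed i)) pairIndex≡q) position≡l))
            (trans (cong (value t l) sign≡s) value≡v)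
      where
      i : ℕ
      i = rowOf t
      sign≡s : isOdd (i + c) xor reversed i ≡ s
      sign≡s = trans (cong (_xor reversed i) (trans (isOdd-+ i c) (cong (isOdd i xor_) parity)))
                     (xor-solve (isOdd i) (reversed i) s)

    labeling-bijective : IsBijectiveLabeling m n labeling
    labeling-bijective =
      (λ { i j (a , b , c , e) →
           value-range (row i) _ (isOdd (i + j) xor reversed i) (row-< i a b) (position-pairIndex-< i j c e) }) ,
      labeling-injective , labeling-surjective

    entryBase : ℕ → ℕ → ℕ
    entryBase i c = start (reversed i) (row i) + step * (pairIndex c ∸ 1)

    labeling-encode : ∀ i c → InRange m n i c → labeling i c ≡ encode N (isOdd (i + c)) (entryBase i c)
    labeling-encode i c (a , b , e , f) =
      value-position (reversed i) (row i) (pairIndex c) (isOdd (i + c)) (row-< i a b)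
        (proj₁ (pairIndex-range c e f)) (proj₂ (pairIndex-range c e f))

    entryBase-≤ : ∀ i c → InRange m n i c → entryBase i c ≤ N
    entryBase-≤ i c (a , b , e , f) =
      start-bound (reversed i) (row i) (pairIndex c) (row-< i a b)
        (proj₁ (pairIndex-range c e f)) (proj₂ (pairIndex-range c e f))

    -- The entries x + 1 and N − y of a face cancel in pairs because the rows are arithmetic progressions.
    face-sum : ∀ r c₁ c₂ r' c₃ c₄ →
      InRange m n r c₁ → InRange m n r c₂ → InRange m n r' c₃ → InRange m n r' c₄ →
      pairIndex c₃ ≡ pairIndex c₁ → pairIndex c₄ ≡ pairIndex c₂ →
      isOdd (r + c₂) ≡ not (isOdd (r + c₁)) → isOdd (r' + c₃) ≡ not (isOdd (r + c₁)) →
      isOdd (r' + c₄) ≡ isOdd (r + c₁) →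
      labeling r c₁ + labeling r c₂ + labeling r' c₃ + labeling r' c₄ ≡ suc N + suc N
    face-sum r c₁ c₂ r' c₃ c₄ x₁ x₂ x₃ x₄ p₃ p₄ o₂ o₃ o₄ =
      trans (cong₂ _+_ (cong₂ _+_ (cong₂ _+_ (labeling-encode r c₁ x₁) e₂) e₃) e₄)
            (encode-face-sum N e P Q D D' (entryBase-≤ r c₁ x₁) (entryBase-≤ r c₂ x₂)
              (subst (_≤ N) (B≡ r' c₃ c₁ p₃) (entryBase-≤ r' c₃ x₃))
              (subst (_≤ N) (B≡ r' c₄ c₂ p₄) (entryBase-≤ r' c₄ x₄)))
      where
      e : Bool
      e = isOdd (r + c₁)
      P Q D D' : ℕ
      P = start (reversed r) (row r)
      Q = start (reversed r') (row r')
      D = step * (pairIndex c₁ ∸ 1)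
      D' = step * (pairIndex c₂ ∸ 1)
      B≡ : ∀ i c c' → pairIndex c ≡ pairIndex c' → entryBase i c ≡ entryBase i c'
      B≡ i c c' p = cong (λ q → start (reversed i) (row i) + step * (q ∸ 1)) p
      e₂ : labeling r c₂ ≡ encode N (not e) (P + D')
      e₂ = trans (labeling-encode r c₂ x₂) (cong (λ s → encode N s (entryBase r c₂)) o₂)
      e₃ : labeling r' c₃ ≡ encode N (not e) (Q + D)
      e₃ = trans (labeling-encode r' c₃ x₃) (cong₂ (encode N) o₃ (B≡ r' c₃ c₁ p₃))
      e₄ : labeling r' c₄ ≡ encode N e (Q + D')
      e₄ = trans (labeling-encode r' c₄ x₄) (cong₂ (encode N) o₄ (B≡ r' c₄ c₂ p₄))

    isOdd-+-next : ∀ i j → 1 ≤ j → j ≤ n → isOdd (i + next j) ≡ not (isOdd (i + j))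
    isOdd-+-next i j 1≤j j≤n = begin
      isOdd (i + next j)              ≡⟨ isOdd-+ i (next j) ⟩
      isOdd i xor isOdd (next j)      ≡⟨ cong (isOdd i xor_) (isOdd-next j 1≤j j≤n) ⟩
      isOdd i xor not (isOdd j)       ≡⟨ sym (not-distribʳ-xor (isOdd i) (isOdd j)) ⟩
      not (isOdd i xor isOdd j)       ≡⟨ cong not (sym (isOdd-+ i j)) ⟩
      not (isOdd (i + j))             ∎
      where open ≡-Reasoning

    labeling-faceMagic : FaceMagic m n labeling
    labeling-faceMagic = suc N + suc N , interior , twisted
      where
      interior : ∀ i j → 1 ≤ i → i ≤ m ∸ 1 → 1 ≤ j → j ≤ n →
        labeling i j + labeling i (next j) + labeling (suc i) j + labeling (suc i) (next j) ≡ suc N + suc N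
      interior i j 1≤i i<m 1≤j j≤n =
        face-sum i j (next j) (suc i) j (next j)
          (1≤i , i≤m , 1≤j , j≤n) (1≤i , i≤m , next-range j)
          (s≤s z≤n , 1+i≤m , 1≤j , j≤n) (s≤s z≤n , 1+i≤m , next-range j)
          refl refl (isOdd-+-next i j 1≤j j≤n) refl
          (trans (cong not (isOdd-+-next i j 1≤j j≤n)) (not-involutive _))
        where
        1+i≤m : suc i ≤ m
        1+i≤m = ≤∸1⇒< 1≤m i<m
        i≤m : i ≤ m
        i≤m = ≤-trans (n≤1+n i) 1+i≤m
      twisted : ∀ j → 1 ≤ j → j ≤ n →
        labeling m j + labeling m (col n (suc j)) + labeling 1 (col n (n + 1 ∸ j)) + labeling 1 (col n (n ∸ j))
          ≡ suc N + suc N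
      twisted j 1≤j j≤n rewrite col-flip j 1≤j j≤n | col-∸-next j 1≤j j≤n =
        face-sum m j (next j) 1 (mirror j) (mirror (next j))
          (1≤m , ≤-refl , 1≤j , j≤n) (1≤m , ≤-refl , next-range j)
          (≤-refl , 1≤m , mirror-range j 1≤j j≤n)
          (≤-refl , 1≤m , mirror-range (next j) (proj₁ (next-range j)) (proj₂ (next-range j)))
          (pairIndex-mirror j 1≤j j≤n) (pairIndex-mirror (next j) (proj₁ (next-range j)) (proj₂ (next-range j)))
          (isOdd-+-next m j 1≤j j≤n)
          (trans (cong not (isOdd-mirror j (≤-trans j≤n (n≤1+n n)))) (cong not (sym (isOdd-m+ j))))
          (trans (cong not (isOdd-mirror (next j) (≤-trans (proj₂ (next-range j)) (n≤1+n n))))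
                 (trans (not-involutive _) (trans (isOdd-next j 1≤j j≤n) (sym (isOdd-m+ j)))))
        where
        isOdd-m+ : ∀ x → isOdd (m + x) ≡ not (isOdd x)
        isOdd-m+ x = trans (isOdd-+ m x) (cong (_xor isOdd x) m-odd)

    rowVertex : ℕ → ℕ → ℕ
    rowVertex r q = vertexOf (row r) (position (reversed r) q)

    vtx-labeling : ∀ r c → InRange m n r c → vtx N (labeling r c) ≡ rowVertex r (pairIndex c)
    vtx-labeling r c (a , b , e , f) =
      vtx-value (row r) _ (isOdd (r + c) xor reversed r) (row-< r a b) (position-pairIndex-< r c e f)

    vtx-labeling-low : ∀ r q → 1 ≤ r → r ≤ m → 1 ≤ q → q ≤ K → vtx N (labeling r q) ≡ rowVertex r q
    vtx-labeling-low r q 1≤r r≤m 1≤q q≤K =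
      trans (vtx-labeling r q (1≤r , r≤m , low-range q 1≤q q≤K)) (cong (rowVertex r) (pairIndex-low q q≤K))

    vtx-labeling-mirror : ∀ r q → 1 ≤ r → r ≤ m → 1 ≤ q → q ≤ K → vtx N (labeling r (mirror q)) ≡ rowVertex r q
    vtx-labeling-mirror r q 1≤r r≤m 1≤q q≤K =
      trans (vtx-labeling r (mirror q) (1≤r , r≤m , mirror-range q 1≤q (proj₂ (low-range q 1≤q q≤K))))
            (cong (rowVertex r) (pairIndex-mirror-low q q≤K))

    -- Both kinds of rows of 𝓛(X) join entries with consecutive pair indices.
    rowGraph : Graph
    rowGraph u v = ∃[ r ] ∃[ q ] (1 ≤ r × r ≤ m × 1 ≤ q × q ≤ n₀ n × UPair u v (rowVertex r q) (rowVertex r (suc q)))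

    LGraph⇒rowGraph : ∀ u v → LGraph m n labeling u v → rowGraph u v
    LGraph⇒rowGraph u v (inj₁ (i , j , 1≤i , i≤ , 1≤j , j≤ , h)) =
      2 * i ∸ 1 , j , r-range .proj₁ , r-range .proj₂ , 1≤j , j≤ ,
      UPair-subst (vtx-labeling-low _ j (r-range .proj₁) (r-range .proj₂) 1≤j (<⇒≤ (≤n₀⇒<K j≤)))
                  (vtx-labeling-low _ (suc j) (r-range .proj₁) (r-range .proj₂) (s≤s z≤n) (≤n₀⇒<K j≤)) h
      where
      r-range : 1 ≤ 2 * i ∸ 1 × 2 * i ∸ 1 ≤ m
      r-range = OddRows.odd-row-range m m-odd i 1≤i i≤
    LGraph⇒rowGraph u v (inj₂ (i , j , 1≤i , i≤ , 1≤j , j≤ , h)) =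
      2 * i , j , r-range .proj₁ , r-range .proj₂ , 1≤j , j≤ ,
      UPair-subst (trans (cong (λ c → vtx N (labeling (2 * i) (c ∸ j))) (+-comm n 1))
                         (vtx-labeling-mirror _ j (r-range .proj₁) (r-range .proj₂) 1≤j (<⇒≤ (≤n₀⇒<K j≤))))
                  (vtx-labeling-mirror _ (suc j) (r-range .proj₁) (r-range .proj₂) (s≤s z≤n) (≤n₀⇒<K j≤)) h
      where
      r-range : 1 ≤ 2 * i × 2 * i ≤ m
      r-range = OddRows.even-row-range m m-odd i 1≤i i≤

    rowGraph⇒LGraph : ∀ u v → rowGraph u v → LGraph m n labeling u v
    rowGraph⇒LGraph u v (r , q , 1≤r , r≤m , 1≤q , q≤ , h) with OddRows.row-cases m m-odd r 1≤r r≤m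
    ... | inj₁ (i , 1≤i , i≤ , refl) = inj₁ (i , q , 1≤i , i≤ , 1≤q , q≤ ,
      UPair-subst (sym (vtx-labeling-low _ q 1≤r r≤m 1≤q (<⇒≤ (≤n₀⇒<K q≤))))
                  (sym (vtx-labeling-low _ (suc q) 1≤r r≤m (s≤s z≤n) (≤n₀⇒<K q≤))) h)
    ... | inj₂ (i , 1≤i , i≤ , refl) = inj₂ (i , q , 1≤i , i≤ , 1≤q , q≤ ,
      UPair-subst (sym (trans (cong (λ c → vtx N (labeling (2 * i) (c ∸ q))) (+-comm n 1))
                              (vtx-labeling-mirror _ q 1≤r r≤m 1≤q (<⇒≤ (≤n₀⇒<K q≤)))))
                  (sym (vtx-labeling-mirror _ (suc q) 1≤r r≤m (s≤s z≤n) (≤n₀⇒<K q≤))) h)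

    K∸j∸1 : ∀ j → K ∸ j ∸ 1 ≡ K ∸ suc j
    K∸j∸1 j = trans (∸-+-assoc K j 1) (cong (K ∸_) (+-comm j 1))

    K∸-range : ∀ j → 1 ≤ j → j ≤ n₀ n → 1 ≤ K ∸ j × K ∸ j ≤ n₀ n
    K∸-range j 1≤j j≤ = m<n⇒0<n∸m (≤n₀⇒<K j≤) , subst (K ∸ j ≤_) (sym n₀≡K∸1) (∸-monoʳ-≤ K 1≤j)

    -- A reversed row traverses path (row r + 1) backwards: its q-th edge is the (K − q)-th edge of the path.
    rowGraph⇒pathGraph : ∀ u v → rowGraph u v → pathGraph u v
    rowGraph⇒pathGraph u v (r , q , 1≤r , r≤m , 1≤q , q≤ , h) with reversed r
    ... | false = suc (row r) , q , s≤s z≤n , row-< r 1≤r r≤m , 1≤q , q≤ , h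
    ... | true = suc (row r) , K ∸ q , s≤s z≤n , row-< r 1≤r r≤m ,
                 K∸-range q 1≤q q≤ .proj₁ , K∸-range q 1≤q q≤ .proj₂ ,
                 UPair-subst (cong (vertexOf (row r)) (sym (K∸j∸1 q))) refl (UPair-swap h)

    pathGraph⇒rowGraph : ∀ u v → pathGraph u v → rowGraph u v
    pathGraph⇒rowGraph u v (suc t , j , _ , t<m , 1≤j , j≤ , h) with reversed (rowOf t) in eq
    ... | false = rowOf t , j , r-range .proj₁ , r-range .proj₂ , 1≤j , j≤ ,
      UPair-subst (cong₂ (λ x y → vertexOf x (position y j)) (sym (row-rowOf t t<m)) (sym eq))
                  (cong₂ (λ x y → vertexOf x (position y (suc j))) (sym (row-rowOf t t<m)) (sym eq)) h
      where
      r-range : 1 ≤ rowOf t × rowOf t ≤ m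
      r-range = rowOf-range t t<m
    ... | true = rowOf t , K ∸ j , r-range .proj₁ , r-range .proj₂ ,
      K∸-range j 1≤j j≤ .proj₁ , K∸-range j 1≤j j≤ .proj₂ ,
      UPair-subst (trans (cong (vertexOf t) (sym (m∸[m∸n]≡n (<⇒≤ (≤n₀⇒<K j≤)))))
                         (cong₂ (λ x y → vertexOf x (position y (K ∸ j))) (sym (row-rowOf t t<m)) (sym eq)))
                  (trans (cong (vertexOf t) (trans (cong (_∸ 1) (sym (m∸[m∸n]≡n (<⇒≤ (≤n₀⇒<K j≤))))) (K∸j∸1 (K ∸ j))))
                         (cong₂ (λ x y → vertexOf x (position y (suc (K ∸ j)))) (sym (row-rowOf t t<m)) (sym eq)))
                  (UPair-swap h)
      where
      r-range : 1 ≤ rowOf t × rowOf t ≤ m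
      r-range = rowOf-range t t<m

    LGraph≈pathGraph : SameGraph (LGraph m n labeling) pathGraph
    LGraph≈pathGraph u v = mk⇔ (λ h → rowGraph⇒pathGraph u v (LGraph⇒rowGraph u v h))
                               (λ h → rowGraph⇒LGraph u v (pathGraph⇒rowGraph u v h))

  first-column-determines-row : ∀ (R R' : RowAssignment m) r → 1 ≤ r → r ≤ m →
    LabelingFor.labeling R r 1 ≡ LabelingFor.labeling R' r 1 →
    RowAssignment.row R r ≡ RowAssignment.row R' r × RowAssignment.reversed R r ≡ RowAssignment.reversed R' r
  first-column-determines-row R R' r 1≤r r≤m e with
    value-injective _ _ _ _ _ _ (LabelingFor.row-< R r 1≤r r≤m) (LabelingFor.position-pairIndex-< R r 1 ≤-refl 1≤n)
                                (LabelingFor.row-< R' r 1≤r r≤m) (LabelingFor.position-pairIndex-< R' r 1 ≤-refl 1≤n) e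
  ... | same-row , _ , same-sign = same-row , xor-cancelˡ (isOdd (r + 1)) _ _ same-sign

-- The symmetries KBLS(m, n)

col-half-mirror-left : ∀ K j R → 1 ≤ j → K ≡ j + R →
  col (K + K) (suc (K + K) ∸ j + K) ≡ suc (K + K) ∸ col (K + K) (j + K)
col-half-mirror-left _ j R 1≤j refl = begin
    col n (suc n ∸ j + (j + R))         ≡⟨ cong (λ z → col n (z + (j + R))) (∸-from-+ (suc n) j _ (r₁ j R)) ⟩
    col n (suc (R + (j + R)) + (j + R)) ≡⟨ cong (col n) (r₂ j R) ⟩
    col n (suc R + n)                   ≡⟨ col-+ n (suc R) ⟩
    col n (suc R)                       ≡⟨ col-id n (suc R) (s≤s z≤n) (≤-trans (+-monoˡ-≤ R 1≤j) (m≤m+n (j + R) (j + R))) ⟩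
    suc R                               ≡⟨ ∸-from-+ (suc n) (j + (j + R)) (suc R) (r₃ j R) ⟨
    suc n ∸ (j + (j + R))               ≡⟨ cong (suc n ∸_) (col-id n (j + (j + R)) (≤-trans 1≤j (m≤m+n j _))
                                                                 (+-monoˡ-≤ (j + R) (m≤m+n j R))) ⟨
    suc n ∸ col n (j + (j + R))         ∎
  where
  open ≡-Reasoning
  n : ℕ
  n = j + R + (j + R)
  r₁ : ∀ j R → suc (j + R + (j + R)) ≡ j + suc (R + (j + R))
  r₁ = solve-∀
  r₂ : ∀ j R → suc (R + (j + R)) + (j + R) ≡ suc R + (j + R + (j + R))
  r₂ = solve-∀
  r₃ : ∀ j R → suc (j + R + (j + R)) ≡ j + (j + R) + suc R
  r₃ = solve-∀

col-half-mirror-right : ∀ K j e S → j ≡ K + suc e → K ≡ suc e + S →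
  col (K + K) (suc (K + K) ∸ j + K) ≡ suc (K + K) ∸ col (K + K) (j + K)
col-half-mirror-right _ _ e S refl refl = begin
    col n (suc n ∸ (K + e′) + K)   ≡⟨ cong (λ z → col n (z + K)) (∸-from-+ (suc n) (K + e′) (suc S) (r₁ e′ S)) ⟩
    col n (suc S + K)              ≡⟨ col-id n (suc (S + K)) (s≤s z≤n) (+-monoˡ-≤ K (s≤s (m≤n+m S e))) ⟩
    suc (S + K)                    ≡⟨ ∸-from-+ (suc n) e′ (suc (S + K)) (r₂ e′ S) ⟨
    suc n ∸ e′                     ≡⟨ cong (suc n ∸_) (trans (cong (col n) (r₃ e′ S))
                                        (trans (col-+ n e′) (col-id n e′ (s≤s z≤n) (≤-trans (m≤m+n e′ S) (m≤m+n K K))))) ⟨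
    suc n ∸ col n (K + e′ + K)     ∎
  where
  open ≡-Reasoning
  e′ K n : ℕ
  e′ = suc e
  K = e′ + S
  n = K + K
  r₁ : ∀ e S → suc (e + S + (e + S)) ≡ e + S + e + suc S
  r₁ = solve-∀
  r₂ : ∀ e S → suc (e + S + (e + S)) ≡ e + suc (S + (e + S))
  r₂ = solve-∀
  r₃ : ∀ e S → e + S + e + (e + S) ≡ e + (e + S + (e + S))
  r₃ = solve-∀

col-half-mirror : ∀ K j → 1 ≤ j → j ≤ K + K →
  col (K + K) (K + K + 1 ∸ j + K) ≡ K + K + 1 ∸ col (K + K) (j + K)
col-half-mirror K j 1≤j j≤n rewrite +-comm (K + K) 1 with j ≤? K
... | yes j≤K = col-half-mirror-left K j (proj₁ (≤-split j≤K)) 1≤j (proj₂ (≤-split j≤K))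
... | no j≰K with ≤-split (≰⇒> j≰K)
...   | e , j≡ = col-half-mirror-right K j e (proj₁ (≤-split 1+e≤K)) j≡K+1+e (proj₂ (≤-split 1+e≤K))
  where
  j≡K+1+e : j ≡ K + suc e
  j≡K+1+e = trans j≡ (sym (+-suc K e))
  1+e≤K : suc e ≤ K
  1+e≤K = +-cancelˡ-≤ K (suc e) K (subst (_≤ K + K) j≡K+1+e j≤n)

-- Every element of KBLS(m, n) commutes with U, so it is determined on the first column by its value at (1, 1).
module Symmetries (m K : ℕ) (1≤K : 1 ≤ K) where

  open Mirror K 1≤K using (n; 1≤n; n/2≡K)

  InR : ℕ × ℕ → Set
  InR (i , j) = InRange m n i j

  flip-range : ∀ j → 1 ≤ j → j ≤ n → 1 ≤ n + 1 ∸ j × n + 1 ∸ j ≤ n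
  flip-range j 1≤j j≤n rewrite +-comm n 1 = m<n⇒0<n∸m (s≤s j≤n) , ∸-monoʳ-≤ (suc n) 1≤j

  act-inRange : ∀ g c → InR c → InR (act m n g c)
  act-inRange U (i , j) (a , b , c , e) with i <ᵇ m in eq
  ... | true = s≤s z≤n , <ᵇ⇒< i m (subst T (sym eq) tt) , c , e
  ... | false = ≤-refl , ≤-trans a b , flip-range j c e
  act-inRange H (i , j) (a , b , c , e) = a , b , col-range n (j + n / 2) 1≤n
  act-inRange F (i , j) (a , b , c , e) = a , b , flip-range j c e

  act-U-comm : ∀ g c → InR c → act m n g (act m n U c) ≡ act m n U (act m n g c)
  act-U-comm U c _ = refl
  act-U-comm H (i , j) (a , b , c , e) with i <ᵇ m
  ... | true = refl
  ... | false rewrite n/2≡K = cong (1 ,_) (col-half-mirror K j c e)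
  act-U-comm F (i , j) (a , b , c , e) with i <ᵇ m
  ... | true = refl
  ... | false = refl

  applyWord-inRange : ∀ w c → InR c → InR (applyWord m n w c)
  applyWord-inRange [] c r = r
  applyWord-inRange (g ∷ w) c r = act-inRange g (applyWord m n w c) (applyWord-inRange w c r)

  applyWord-U-comm : ∀ w c → InR c → applyWord m n w (act m n U c) ≡ act m n U (applyWord m n w c)
  applyWord-U-comm [] c r = refl
  applyWord-U-comm (g ∷ w) c r =
    trans (cong (act m n g) (applyWord-U-comm w c r)) (act-U-comm g (applyWord m n w c) (applyWord-inRange w c r))

  U-first-column : ∀ i → i < m → act m n U (i , 1) ≡ (suc i , 1)
  U-first-column i i<m with i <ᵇ m in eq
  ... | true = refl
  ... | false with subst T eq (<⇒<ᵇ i<m)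
  ...   | ()

  KBEquivalent-first-column : (X X' : Labeling) →
    (∀ i j i' j' → InRange m n i j → InRange m n i' j' → X i j ≡ X i' j' → i ≡ i' × j ≡ j') →
    X 1 1 ≡ X' 1 1 → 1 ≤ m → KBEquivalent m n X X' → ∀ i → 1 ≤ i → i ≤ m → X' i 1 ≡ X i 1
  KBEquivalent-first-column X X' X-injective corner 1≤m (w , X'≡) i 1≤i i≤m =
    trans (X'≡ i 1 (1≤i , i≤m , ≤-refl , 1≤n)) (cong (λ c → X (proj₁ c) (proj₂ c)) (fixes i 1≤i i≤m))
    where
    A : ℕ × ℕ → ℕ × ℕ
    A = applyWord m n w
    corner-range : InR (1 , 1)
    corner-range = ≤-refl , 1≤m , ≤-refl , 1≤n
    fixes-corner : A (1 , 1) ≡ (1 , 1)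
    fixes-corner with X-injective (proj₁ (A (1 , 1))) (proj₂ (A (1 , 1))) 1 1 (applyWord-inRange w (1 , 1) corner-range)
                        corner-range (trans (sym (X'≡ 1 1 corner-range)) (sym corner))
    ... | p , q = cong₂ _,_ p q
    fixes : ∀ i → 1 ≤ i → i ≤ m → A (i , 1) ≡ (i , 1)
    fixes (suc zero) _ _ = fixes-corner
    fixes (suc (suc i)) _ i<m = begin
        A (suc (suc i) , 1)            ≡⟨ cong A (sym (U-first-column (suc i) i<m)) ⟩
        A (act m n U (suc i , 1))      ≡⟨ applyWord-U-comm w (suc i , 1) (s≤s z≤n , <⇒≤ i<m , ≤-refl , 1≤n) ⟩
        act m n U (A (suc i , 1))      ≡⟨ cong (act m n U) (fixes (suc i) (s≤s z≤n) (<⇒≤ i<m)) ⟩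
        act m n U (suc i , 1)          ≡⟨ U-first-column (suc i) i<m ⟩
        (suc (suc i) , 1)              ∎
      where open ≡-Reasoning

-- Signed permutations

punchIn : ℕ → ℕ → ℕ
punchIn zero v = suc v
punchIn (suc j) zero = zero
punchIn (suc j) (suc v) = suc (punchIn j v)

punchOut : ℕ → ℕ → ℕ
punchOut zero t = pred t
punchOut (suc j) zero = zero
punchOut (suc j) (suc t) = suc (punchOut j t)

punchIn-≢ : ∀ j v → ¬ punchIn j v ≡ j
punchIn-≢ (suc j) (suc v) e = punchIn-≢ j v (suc-injective e)

punchIn-injective : ∀ j v v' → punchIn j v ≡ punchIn j v' → v ≡ v'
punchIn-injective zero v v' e = suc-injective e
punchIn-injective (suc j) zero zero e = refl
punchIn-injective (suc j) (suc v) (suc v') e = cong suc (punchIn-injective j v v' (suc-injective e))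

punchIn-< : ∀ j v k → v < k → j < suc k → punchIn j v < suc k
punchIn-< zero v k v<k _ = s≤s v<k
punchIn-< (suc j) zero k _ _ = s≤s z≤n
punchIn-< (suc j) (suc v) (suc k) (s≤s v<k) (s≤s j<k) = s≤s (punchIn-< j v k v<k j<k)

punchOut-< : ∀ j t k → t < suc k → ¬ t ≡ j → j < suc k → punchOut j t < k
punchOut-< zero zero k _ t≢j _ = ⊥-elim (t≢j refl)
punchOut-< zero (suc t) k (s≤s t<k) _ _ = t<k
punchOut-< (suc j) zero (suc k) _ _ _ = s≤s z≤n
punchOut-< (suc j) zero zero _ _ (s≤s ())
punchOut-< (suc j) (suc t) (suc k) (s≤s t<) t≢j (s≤s j<) = s≤s (punchOut-< j t k t< (λ e → t≢j (cong suc e)) j<)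

punchIn-punchOut : ∀ j t → ¬ t ≡ j → punchIn j (punchOut j t) ≡ t
punchIn-punchOut zero zero t≢j = ⊥-elim (t≢j refl)
punchIn-punchOut zero (suc t) _ = refl
punchIn-punchOut (suc j) zero _ = refl
punchIn-punchOut (suc j) (suc t) t≢j = cong suc (punchIn-punchOut j t (λ e → t≢j (cong suc e)))

punchOut-punchIn : ∀ j v → punchOut j (punchIn j v) ≡ v
punchOut-punchIn zero v = refl
punchOut-punchIn (suc j) zero = refl
punchOut-punchIn (suc j) (suc v) = cong suc (punchOut-punchIn j v)

record SignedPermutation (k : ℕ) : Set where
  field
    perm perm⁻¹ : ℕ → ℕ
    sign : ℕ → Bool
    perm-< : ∀ i → i < k → perm i < k
    perm⁻¹-< : ∀ t → t < k → perm⁻¹ t < k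
    perm-perm⁻¹ : ∀ t → t < k → perm (perm⁻¹ t) ≡ t
    perm⁻¹-perm : ∀ i → i < k → perm⁻¹ (perm i) ≡ i

lowBit : ℕ → Bool
lowBit x = x % 2 ≡ᵇ 1

-- The mixed-radix digits of x: x % 2 is the sign of 0, (x / 2) % (k + 1) its image,
-- and (x / 2) / (k + 1) encodes the rest; so x < 2^k k! runs through all signed permutations.
signedPermutation : (k : ℕ) → ℕ → SignedPermutation k
signedPermutation zero x = record
  { perm = λ i → i ; perm⁻¹ = λ t → t ; sign = λ _ → false
  ; perm-< = λ _ p → p ; perm⁻¹-< = λ _ p → p ; perm-perm⁻¹ = λ _ _ → refl ; perm⁻¹-perm = λ _ _ → refl }
signedPermutation (suc k) x = record
  { perm = perm ; perm⁻¹ = perm⁻¹ ; sign = sign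
  ; perm-< = perm-< ; perm⁻¹-< = perm⁻¹-< ; perm-perm⁻¹ = perm-perm⁻¹ ; perm⁻¹-perm = perm⁻¹-perm }
  where
  j : ℕ
  j = (x / 2) % suc k
  P : SignedPermutation k
  P = signedPermutation k ((x / 2) / suc k)
  module P = SignedPermutation P
  j<1+k : j < suc k
  j<1+k = m%n<n (x / 2) (suc k)
  perm : ℕ → ℕ
  perm zero = j
  perm (suc i) = punchIn j (P.perm i)
  sign : ℕ → Bool
  sign zero = lowBit x
  sign (suc i) = P.sign i
  perm⁻¹ : ℕ → ℕ
  perm⁻¹ t with t ≟ j
  ... | yes _ = 0
  ... | no _ = suc (P.perm⁻¹ (punchOut j t))
  perm-< : ∀ i → i < suc k → perm i < suc k
  perm-< zero _ = j<1+k
  perm-< (suc i) (s≤s i<k) = punchIn-< j (P.perm i) k (P.perm-< i i<k) j<1+k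
  perm⁻¹-< : ∀ t → t < suc k → perm⁻¹ t < suc k
  perm⁻¹-< t t< with t ≟ j
  ... | yes _ = s≤s z≤n
  ... | no t≢j = s≤s (P.perm⁻¹-< (punchOut j t) (punchOut-< j t k t< t≢j j<1+k))
  perm-perm⁻¹ : ∀ t → t < suc k → perm (perm⁻¹ t) ≡ t
  perm-perm⁻¹ t t< with t ≟ j
  ... | yes e = sym e
  ... | no t≢j = trans (cong (punchIn j) (P.perm-perm⁻¹ (punchOut j t) (punchOut-< j t k t< t≢j j<1+k)))
                       (punchIn-punchOut j t t≢j)
  perm⁻¹-perm : ∀ i → i < suc k → perm⁻¹ (perm i) ≡ i
  perm⁻¹-perm zero _ with j ≟ j
  ... | yes _ = refl
  ... | no j≢j = ⊥-elim (j≢j refl)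
  perm⁻¹-perm (suc i) (s≤s i<k) with punchIn j (P.perm i) ≟ j
  ... | yes e = ⊥-elim (punchIn-≢ j (P.perm i) e)
  ... | no _ = cong suc (trans (cong P.perm⁻¹ (punchOut-punchIn j (P.perm i))) (P.perm⁻¹-perm i i<k))

lowBit-injective : ∀ x y → lowBit x ≡ lowBit y → x % 2 ≡ y % 2
lowBit-injective x y = digits (x % 2) (y % 2) (m%n<n x 2) (m%n<n y 2)
  where
  digits : ∀ a b → a < 2 → b < 2 → (a ≡ᵇ 1) ≡ (b ≡ᵇ 1) → a ≡ b
  digits zero zero _ _ _ = refl
  digits (suc zero) (suc zero) _ _ _ = refl
  digits zero (suc zero) _ _ ()
  digits (suc zero) zero _ _ ()
  digits (suc (suc a)) _ (s≤s (s≤s ())) _ _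
  digits _ (suc (suc b)) _ (s≤s (s≤s ())) _

signedPermutation-injective : ∀ k x y → x < 2 ^ k * k ! → y < 2 ^ k * k ! →
  (∀ i → i < k → SignedPermutation.perm (signedPermutation k x) i ≡ SignedPermutation.perm (signedPermutation k y) i ×
                 SignedPermutation.sign (signedPermutation k x) i ≡ SignedPermutation.sign (signedPermutation k y) i) →
  x ≡ y
signedPermutation-injective zero zero zero _ _ _ = refl
signedPermutation-injective zero (suc x) y (s≤s ()) _ _
signedPermutation-injective zero zero (suc y) _ (s≤s ()) _
signedPermutation-injective (suc k) x y x< y< agree =
  trans (digits x) (trans (cong₃ same-sign same-image same-rest) (sym (digits y)))
  where
  digits : ∀ x → x ≡ x % 2 + ((x / 2) % suc k + ((x / 2) / suc k) * suc k) * 2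
  digits x = trans (m≡m%n+[m/n]*n x 2) (cong (λ z → x % 2 + z * 2) (m≡m%n+[m/n]*n (x / 2) (suc k)))
  cong₃ : ∀ {a a' b b' c c'} → a ≡ a' → b ≡ b' → c ≡ c' → a + (b + c * suc k) * 2 ≡ a' + (b' + c' * suc k) * 2
  cong₃ refl refl refl = refl
  same-sign : x % 2 ≡ y % 2
  same-sign = lowBit-injective x y (proj₂ (agree 0 (s≤s z≤n)))
  same-image : (x / 2) % suc k ≡ (y / 2) % suc k
  same-image = proj₁ (agree 0 (s≤s z≤n))
  rest-< : ∀ x → x < 2 ^ suc k * suc k ! → (x / 2) / suc k < 2 ^ k * k !
  rest-< x x< = subst (_< 2 ^ k * k !) (sym (m/n/o≡m/[n*o] x 2 (suc k)))
                  (m<n*o⇒m/o<n (subst (x <_) (regroup (2 ^ k) (k !) k) x<))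
    where
    regroup : ∀ P F k → 2 * P * (suc k * F) ≡ P * F * (2 * suc k)
    regroup = solve-∀
  same-rest : (x / 2) / suc k ≡ (y / 2) / suc k
  same-rest = signedPermutation-injective k _ _ (rest-< x x<) (rest-< y y<) λ i i<k →
    punchIn-injective ((x / 2) % suc k) _ _
      (trans (proj₁ (agree (suc i) (s≤s i<k)))
             (cong (λ z → punchIn z (SignedPermutation.perm (signedPermutation k ((y / 2) / suc k)) i)) (sym same-image))) ,
    proj₂ (agree (suc i) (s≤s i<k))

firstRowFixed : ∀ {k} → SignedPermutation k → RowAssignment (suc k)
firstRowFixed {k} P = record
  { row = row ; rowOf = rowOf ; reversed = reversed
  ; row-< = row-< ; rowOf-range = rowOf-range ; row-rowOf = row-rowOf ; rowOf-row = rowOf-row }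
  where
  open SignedPermutation P
  row : ℕ → ℕ
  row (suc (suc i)) = suc (perm i)
  row _ = 0
  rowOf : ℕ → ℕ
  rowOf zero = 1
  rowOf (suc t) = suc (suc (perm⁻¹ t))
  reversed : ℕ → Bool
  reversed (suc (suc i)) = sign i
  reversed _ = false
  row-< : ∀ i → 1 ≤ i → i ≤ suc k → row i < suc k
  row-< (suc zero) _ _ = s≤s z≤n
  row-< (suc (suc i)) _ (s≤s i<k) = s≤s (perm-< i i<k)
  rowOf-range : ∀ t → t < suc k → 1 ≤ rowOf t × rowOf t ≤ suc k
  rowOf-range zero _ = s≤s z≤n , s≤s z≤n
  rowOf-range (suc t) (s≤s t<k) = s≤s z≤n , s≤s (perm⁻¹-< t t<k)
  row-rowOf : ∀ t → t < suc k → row (rowOf t) ≡ t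
  row-rowOf zero _ = refl
  row-rowOf (suc t) (s≤s t<k) = cong suc (perm-perm⁻¹ t t<k)
  rowOf-row : ∀ i → 1 ≤ i → i ≤ suc k → rowOf (row i) ≡ i
  rowOf-row (suc zero) _ _ = refl
  rowOf-row (suc (suc i)) _ (s≤s i<k) = cong (λ z → suc (suc z)) (perm⁻¹-perm i i<k)

-- The four splittings

[r+q*d]/d≡q : ∀ r q d → r < suc d → (r + q * suc d) / suc d ≡ q
[r+q*d]/d≡q r q d r<d = trans (+-distrib-/-∣ʳ r (divides-refl q)) (cong₂ _+_ (m<n⇒m/n≡0 r<d) (m*n/n≡m q (suc d)))

[r+q*d]%d≡r : ∀ r q d → r < suc d → (r + q * suc d) % suc d ≡ r
[r+q*d]%d≡r r q d r<d = trans ([m+kn]%n≡m%n r q (suc d)) (m<n⇒m%n≡m r<d)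

record LinearIndexing (m K : ℕ) : Set where
  field
    index : ℕ → ℕ → ℕ
    stride : ℕ
    unindex : ℕ → ℕ × ℕ
    index-linear : ∀ t l → index t l ≡ index t 0 + stride * l
    index-< : ∀ t l → t < m → l < K → index t l < m * K
    unindex-index : ∀ t l → t < m → l < K → unindex (index t l) ≡ (t , l)
    index-unindex : ∀ x → x < m * K →
      proj₁ (unindex x) < m × proj₂ (unindex x) < K × index (proj₁ (unindex x)) (proj₂ (unindex x)) ≡ x

rowMajor : ∀ m K → LinearIndexing m (suc K)
rowMajor m K' = record
  { index = λ t l → K * t + l ; stride = 1 ; unindex = λ x → x / K , x % K
  ; index-linear = λ t l → linear K t l ; index-< = index-< ; unindex-index = unindex-index ; index-unindex = index-unindex }
  where
  K : ℕ
  K = suc K'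
  linear : ∀ K t l → K * t + l ≡ K * t + 0 + 1 * l
  linear = solve-∀
  index-< : ∀ t l → t < m → l < K → K * t + l < m * K
  index-< t l t<m l<K = begin-strict
      K * t + l    <⟨ +-monoʳ-< (K * t) l<K ⟩
      K * t + K    ≡⟨ regroup K t ⟩
      suc t * K    ≤⟨ *-monoˡ-≤ K t<m ⟩
      m * K        ∎
    where
    open ≤-Reasoning
    regroup : ∀ K t → K * t + K ≡ suc t * K
    regroup = solve-∀
  unindex-index : ∀ t l → t < m → l < K → ((K * t + l) / K , (K * t + l) % K) ≡ (t , l)
  unindex-index t l _ l<K = trans (cong (λ z → z / K , z % K) (regroup K t l))
                                  (cong₂ _,_ ([r+q*d]/d≡q l t K' l<K) ([r+q*d]%d≡r l t K' l<K))
    where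
    regroup : ∀ K t l → K * t + l ≡ l + t * K
    regroup = solve-∀
  index-unindex : ∀ x → x < m * K → x / K < m × x % K < K × K * (x / K) + x % K ≡ x
  index-unindex x x< = m<n*o⇒m/o<n x< , m%n<n x K , trans (regroup K (x / K) (x % K)) (sym (m≡m%n+[m/n]*n x K))
    where
    regroup : ∀ K q r → K * q + r ≡ r + q * K
    regroup = solve-∀

columnMajor : ∀ m K → LinearIndexing (suc m) K
columnMajor m' K = record
  { index = λ t l → t + m * l ; stride = m ; unindex = λ x → x % m , x / m
  ; index-linear = λ t l → linear m t l ; index-< = index-< ; unindex-index = unindex-index ; index-unindex = index-unindex }
  where
  m : ℕ
  m = suc m'
  linear : ∀ m t l → t + m * l ≡ t + m * 0 + m * l
  linear = solve-∀
  index-< : ∀ t l → t < m → l < K → t + m * l < m * K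
  index-< t l t<m l<K = begin-strict
      t + m * l    <⟨ +-monoˡ-< (m * l) t<m ⟩
      m + m * l    ≡⟨ regroup m l ⟩
      m * suc l    ≤⟨ *-monoʳ-≤ m l<K ⟩
      m * K        ∎
    where
    open ≤-Reasoning
    regroup : ∀ m l → m + m * l ≡ m * suc l
    regroup = solve-∀
  unindex-index : ∀ t l → t < m → l < K → ((t + m * l) % m , (t + m * l) / m) ≡ (t , l)
  unindex-index t l t<m _ = trans (cong (λ z → z % m , z / m) (cong (t +_) (*-comm m l)))
                                  (cong₂ _,_ ([r+q*d]%d≡r t l m' t<m) ([r+q*d]/d≡q t l m' t<m))
  index-unindex : ∀ x → x < m * K → x % m < m × x / m < K × x % m + m * (x / m) ≡ x
  index-unindex x x< = m%n<n x m , m<n*o⇒m/o<n (subst (x <_) (*-comm m K) x<) ,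
                       trans (cong (x % m +_) (*-comm m (x / m))) (sym (m≡m%n+[m/n]*n x m))

left-inverse⇒injective : ∀ {m K} (f : ℕ → ℕ → Bool → ℕ) (decode : ℕ → ℕ × ℕ × Bool) →
  (∀ t l s → t < m → l < K → decode (f t l s) ≡ (t , l , s)) →
  ∀ t l s t' l' s' → t < m → l < K → t' < m → l' < K → f t l s ≡ f t' l' s' → t ≡ t' × l ≡ l' × s ≡ s'
left-inverse⇒injective f decode decode-f t l s t' l' s' t<m l<K t'<m l'<K e =
  cong proj₁ same , cong (λ z → proj₁ (proj₂ z)) same , cong (λ z → proj₂ (proj₂ z)) same
  where
  same : (t , l , s) ≡ (t' , l' , s')
  same = trans (sym (decode-f t l s t<m l<K)) (trans (cong decode e) (decode-f t' l' s' t'<m l'<K))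

-- The values 1, …, mK are index + 1 and the values mK + 1, …, 2mK are N − index.
module HalfScheme {m K : ℕ} (I : LinearIndexing m K) where
  open LinearIndexing I
  h N : ℕ
  h = m * K
  N = m * (K + K)
  N≡ : N ≡ h + h
  N≡ = *-distribˡ-+ m K K
  base-< : ∀ t l → t < m → l < K → index t l < N
  base-< t l t<m l<K = <-≤-trans (index-< t l t<m l<K) (subst (h ≤_) (sym N≡) (m≤m+n h h))
  decodeWith : ∀ y → Dec (y ≤ h) → ℕ × ℕ × Bool
  decodeWith y (yes _) = proj₁ (unindex (y ∸ 1)) , proj₂ (unindex (y ∸ 1)) , false
  decodeWith y (no _) = proj₁ (unindex (N ∸ y)) , proj₂ (unindex (N ∸ y)) , true
  decode : ℕ → ℕ × ℕ × Bool
  decode y = decodeWith y (y ≤? h)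
  N∸index≰h : ∀ t l → t < m → l < K → ¬ N ∸ index t l ≤ h
  N∸index≰h t l t<m l<K p = <⇒≱ (index-< t l t<m l<K) (begin
      h                       ≡⟨ m+n∸m≡n h h ⟨
      h + h ∸ h               ≤⟨ ∸-monoʳ-≤ (h + h) p ⟩
      h + h ∸ (N ∸ index t l) ≡⟨ cong (_∸ (N ∸ index t l)) (sym N≡) ⟩
      N ∸ (N ∸ index t l)     ≡⟨ m∸[m∸n]≡n (<⇒≤ (base-< t l t<m l<K)) ⟩
      index t l               ∎)
    where open ≤-Reasoning
  decode-value : ∀ t l s → t < m → l < K → decode (encode N s (index t l)) ≡ (t , l , s)
  decode-value t l false t<m l<K with suc (index t l) ≤? h
  ... | yes _ = cong (λ z → proj₁ z , proj₂ z , false) (unindex-index t l t<m l<K)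
  ... | no ≰h = ⊥-elim (≰h (index-< t l t<m l<K))
  decode-value t l true t<m l<K with N ∸ index t l ≤? h
  ... | yes ≤h = ⊥-elim (N∸index≰h t l t<m l<K ≤h)
  ... | no _ = cong (λ z → proj₁ z , proj₂ z , true)
                 (trans (cong unindex (m∸[m∸n]≡n (<⇒≤ (base-< t l t<m l<K)))) (unindex-index t l t<m l<K))
  value-surjective : ∀ y → Dec (y ≤ h) → 1 ≤ y → y ≤ N →
    ∃[ t ] ∃[ l ] ∃[ s ] (t < m × l < K × encode N s (index t l) ≡ y)
  value-surjective (suc y) (yes y<h) _ _ =
    let (t<m , l<K , index≡) = index-unindex y y<h in _ , _ , false , t<m , l<K , cong suc index≡
  value-surjective y (no y≰h) _ y≤N =
    let (t<m , l<K , index≡) = index-unindex (N ∸ y) N∸y<h in _ , _ , true , t<m , l<K ,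
      trans (cong (N ∸_) index≡) (m∸[m∸n]≡n y≤N)
    where
    N∸y<h : N ∸ y < h
    N∸y<h = begin-strict
      N ∸ y       <⟨ ∸-monoʳ-< (≰⇒> y≰h) y≤N ⟩
      N ∸ h       ≡⟨ cong (_∸ h) N≡ ⟩
      h + h ∸ h   ≡⟨ m+n∸m≡n h h ⟩
      h           ∎
      where open ≤-Reasoning

  scheme : LabelScheme m K
  scheme = record
    { step = stride ; base = index ; base-linear = index-linear ; base-< = base-<
    ; value-injective = left-inverse⇒injective (λ t l s → encode N s (index t l)) decode decode-value
    ; value-surjective = λ y 1≤y y≤N → value-surjective y (y ≤? h) 1≤y y≤N }

double∸double : ∀ h x → x ≤ h → h + h ∸ (x + x) ≡ (h ∸ x) + (h ∸ x)
double∸double h x x≤h with ≤-split x≤h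
... | R , refl = trans (∸-from-+ (x + R + (x + R)) (x + x) (R + R) (regroup x R))
                       (sym (cong₂ _+_ (m+n∸m≡n x R) (m+n∸m≡n x R)))
  where
  regroup : ∀ x R → x + R + (x + R) ≡ x + x + (R + R)
  regroup = solve-∀

-- The odd values are 2 index + 1 and the even values are N − 2 index.
module DoubledScheme {m K : ℕ} (I : LinearIndexing m K) where
  open LinearIndexing I
  h N : ℕ
  h = m * K
  N = m * (K + K)
  N≡ : N ≡ h + h
  N≡ = *-distribˡ-+ m K K
  base-linear : ∀ t l → 2 * index t l ≡ 2 * index t 0 + 2 * stride * l
  base-linear t l = trans (cong (2 *_) (index-linear t l)) (distrib (index t 0) stride l)
    where
    distrib : ∀ a b l → 2 * (a + b * l) ≡ 2 * a + 2 * b * l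
    distrib = solve-∀
  base-< : ∀ t l → t < m → l < K → 2 * index t l < N
  base-< t l t<m l<K = subst₂ _≤_ (cong suc (sym (2*≡double (index t l)))) (sym N≡)
                         (+-mono-≤ (index-< t l t<m l<K) (<⇒≤ (index-< t l t<m l<K)))
  2*x/2 : ∀ x → 2 * x / 2 ≡ x
  2*x/2 x = trans (cong (_/ 2) (2*≡double x)) (double/2 x)
  N∸2* : ∀ x → x ≤ h → N ∸ 2 * x ≡ (h ∸ x) + (h ∸ x)
  N∸2* x x≤h = trans (cong₂ _∸_ N≡ (2*≡double x)) (double∸double h x x≤h)
  isOdd-2* : ∀ x → isOdd (2 * x) ≡ false
  isOdd-2* x = trans (cong isOdd (2*≡double x)) (isOdd-double x)
  decodeWith : ∀ y → Dec (isOdd y ≡ true) → ℕ × ℕ × Bool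
  decodeWith y (yes _) = proj₁ (unindex ((y ∸ 1) / 2)) , proj₂ (unindex ((y ∸ 1) / 2)) , false
  decodeWith y (no _) = proj₁ (unindex ((N ∸ y) / 2)) , proj₂ (unindex ((N ∸ y) / 2)) , true
  decode : ℕ → ℕ × ℕ × Bool
  decode y = decodeWith y (isOdd y Bool.≟ true)
  decode-value : ∀ t l s → t < m → l < K → decode (encode N s (2 * index t l)) ≡ (t , l , s)
  decode-value t l false t<m l<K with isOdd (suc (2 * index t l)) Bool.≟ true
  ... | yes _ = cong (λ z → proj₁ z , proj₂ z , false)
                  (trans (cong unindex (2*x/2 (index t l))) (unindex-index t l t<m l<K))
  ... | no not-odd = ⊥-elim (not-odd (cong not (isOdd-2* (index t l))))
  decode-value t l true t<m l<K with isOdd (N ∸ 2 * index t l) Bool.≟ true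
  ... | yes odd = ⊥-elim (not-¬ refl (trans (sym odd)
                    (trans (cong isOdd (N∸2* (index t l) (<⇒≤ (index-< t l t<m l<K)))) (isOdd-double (h ∸ index t l)))))
  ... | no _ = cong (λ z → proj₁ z , proj₂ z , true)
                 (trans (cong (λ z → unindex (z / 2)) (m∸[m∸n]≡n (<⇒≤ (base-< t l t<m l<K))))
                        (trans (cong unindex (2*x/2 (index t l))) (unindex-index t l t<m l<K)))
  value-surjective : ∀ y → Dec (isOdd y ≡ true) → 1 ≤ y → y ≤ N →
    ∃[ t ] ∃[ l ] ∃[ s ] (t < m × l < K × encode N s (2 * index t l) ≡ y)
  value-surjective y (yes odd) _ y≤N with odd⇒suc-double y odd
  ... | q , refl = let (t<m , l<K , index≡) = index-unindex q q<h in _ , _ , false , t<m , l<K ,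
                   cong suc (trans (cong (2 *_) index≡) (2*≡double q))
    where
    q<h : q < h
    q<h = double-< q h (subst (suc (q + q) ≤_) N≡ y≤N)
  value-surjective y (no not-odd) 1≤y y≤N with even⇒double y (Bool.¬-not not-odd)
  ... | q , refl = let (t<m , l<K , index≡) = index-unindex x x<h in _ , _ , true , t<m , l<K ,
                   trans (N∸2* _ (<⇒≤ (subst (_< h) (sym index≡) x<h)))
                         (trans (cong (λ z → (h ∸ z) + (h ∸ z)) (trans index≡ x≡))
                                (cong₂ _+_ (m∸[m∸n]≡n q≤h) (m∸[m∸n]≡n q≤h)))
    where
    q≤h : q ≤ h
    q≤h = double-≤ q h (subst (q + q ≤_) N≡ y≤N)
    1≤q : 1 ≤ q
    1≤q = 1≤double⇒1≤ q 1≤y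
    x : ℕ
    x = (N ∸ (q + q)) / 2
    x≡ : x ≡ h ∸ q
    x≡ = trans (cong (λ z → (z ∸ (q + q)) / 2) N≡) (trans (cong (_/ 2) (double∸double h q q≤h)) (double/2 (h ∸ q)))
    x<h : x < h
    x<h = subst (_< h) (sym x≡) (∸-monoʳ-< 1≤q q≤h)

  scheme : LabelScheme m K
  scheme = record
    { step = 2 * stride ; base = λ t l → 2 * index t l ; base-linear = base-linear ; base-< = base-<
    ; value-injective = left-inverse⇒injective (λ t l s → encode N s (2 * index t l)) decode decode-value
    ; value-surjective = λ y 1≤y y≤N → value-surjective y (isOdd y Bool.≟ true) 1≤y y≤N }

-- The sequences (a_j)

alternating : ℕ → ℕ → ℕ → List ℕ
alternating α β zero = α ∷ []
alternating α β (suc r) = α ∷ β ∷ alternating α β r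

alternating-snoc : ∀ α β r → alternating α β (suc r) ≡ alternating α β r ++ (β ∷ α ∷ [])
alternating-snoc α β zero = refl
alternating-snoc α β (suc r) = cong (λ z → α ∷ β ∷ z) (alternating-snoc α β r)

alternating-palindrome : ∀ α β r → Palindrome (alternating α β r)
alternating-palindrome α β zero = refl
alternating-palindrome α β (suc r) = sym (begin
    reverse (alternating α β (suc r))                ≡⟨ cong reverse (alternating-snoc α β r) ⟩
    reverse (alternating α β r ++ (β ∷ α ∷ []))      ≡⟨ reverse-++ (alternating α β r) (β ∷ α ∷ []) ⟩
    α ∷ β ∷ reverse (alternating α β r)              ≡⟨ cong (λ z → α ∷ β ∷ z) (sym (alternating-palindrome α β r)) ⟩
    alternating α β (suc r)                          ∎)
  where open ≡-Reasoning

applyUpTo-alternating : ∀ α β r (f : ℕ → ℕ) →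
  (∀ j → j < suc (r + r) → f j ≡ (if isOdd (suc j) then α else β)) →
  applyUpTo f (suc (r + r)) ≡ alternating α β r
applyUpTo-alternating α β zero f f≡ = cong (_∷ []) (f≡ 0 (s≤s z≤n))
applyUpTo-alternating α β (suc r) f f≡ rewrite +-suc r r =
  cong₂ _∷_ (f≡ 0 (s≤s z≤n)) (cong₂ _∷_ (f≡ 1 (s≤s (s≤s z≤n)))
    (applyUpTo-alternating α β r (λ j → f (suc (suc j)))
      (λ j j< → trans (f≡ (suc (suc j)) (s≤s (s≤s j<)))
                      (cong (λ b → if b then α else β) (not-involutive (isOdd (suc j)))))))

alternating-sequence-palindrome : ∀ α β R (a : ℕ → ℕ) → 1 ≤ R →
  (∀ j → 1 ≤ j → j < R + R → a j ≡ (if isOdd j then α else β)) →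
  Palindrome (map (λ j → a (suc j)) (upTo (R + R ∸ 1)))
alternating-sequence-palindrome α β (suc r) a _ a≡ = trans as-alternating
  (trans (alternating-palindrome α β r) (cong reverse (sym as-alternating)))
  where
  as-alternating : map (λ j → a (suc j)) (upTo (suc r + suc r ∸ 1)) ≡ alternating α β r
  as-alternating rewrite +-suc r r =
    trans (map-applyUpTo (λ x → x) (λ j → a (suc j)) (suc (r + r)))
          (applyUpTo-alternating α β r (λ j → a (suc j)) (λ j j< → a≡ (suc j) (s≤s z≤n) (s≤s j<)))

seqCase-alternating : ∀ α β R (a : ℕ → ℕ) →
  (∀ k → 1 ≤ k → k ≤ R → a (2 * k ∸ 1) ≡ α) → (∀ k → 1 ≤ k → k ≤ R ∸ 1 → a (2 * k) ≡ β) →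
  ∀ j → 1 ≤ j → j < R + R → a j ≡ (if isOdd j then α else β)
seqCase-alternating α β R a odd-α even-β j 1≤j j< with isOdd j in eq
... | true with odd⇒suc-double j eq
...   | h , refl = trans (cong a (sym (2*[1+i]∸1 h))) (odd-α (suc h) (s≤s z≤n) (double-< h R (≤-trans (n≤1+n _) j<)))
seqCase-alternating α β R a odd-α even-β j 1≤j j< | false with even⇒double j eq
...   | zero , refl = ⊥-elim (<⇒≱ 1≤j z≤n)
...   | suc h , refl = trans (cong a (sym (2*≡double (suc h))))
                             (even-β (suc h) (s≤s z≤n) (<⇒≤∸1 (double-< (suc h) R j<)))
  where
  <⇒≤∸1 : ∀ {x y} → x < y → x ≤ y ∸ 1
  <⇒≤∸1 {y = suc y} (s≤s x≤y) = x≤y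

Realises : ∀ {m K} → LabelScheme m K → ℕ → ℕ → Set
Realises {m} {K} S α β =
  α ≡ suc (m * (K + K)) ∸ LabelScheme.step S × β ≡ suc (m * (K + K)) + LabelScheme.step S

module Construction {m K : ℕ} (1≤K : 1 ≤ K) (m-odd : isOdd (suc m) ≡ true) (S : LabelScheme (suc m) K) where

  open SchemeLabeling 1≤K m-odd S

  module LabelingOf (p : Fin (2 ^ m * m !)) = LabelingFor (firstRowFixed (signedPermutation m (toℕ p)))

  labelingOf : Fin (2 ^ m * m !) → Labeling
  labelingOf p = LabelingOf.labeling p

  -- All these labelings agree at (1, 1), so an equivalence between two of them fixes the first
  -- column, whose entries determine the signed permutation.
  labelingOf-inequivalent : ∀ p q → ¬ p ≡ q → ¬ KBEquivalent (suc m) n (labelingOf p) (labelingOf q)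
  labelingOf-inequivalent p q p≢q equivalent =
    p≢q (sym (toℕ-injective (signedPermutation-injective m (toℕ q) (toℕ p) (toℕ<n q) (toℕ<n p) agree)))
    where
    same-column : ∀ i → 1 ≤ i → i ≤ suc m → labelingOf q i 1 ≡ labelingOf p i 1
    same-column = Symmetries.KBEquivalent-first-column (suc m) K 1≤K (labelingOf p) (labelingOf q)
                    (LabelingOf.labeling-injective p) refl (s≤s z≤n) equivalent
    agree : ∀ i → i < m →
      SignedPermutation.perm (signedPermutation m (toℕ q)) i ≡ SignedPermutation.perm (signedPermutation m (toℕ p)) i ×
      SignedPermutation.sign (signedPermutation m (toℕ q)) i ≡ SignedPermutation.sign (signedPermutation m (toℕ p)) i
    agree i i<m with first-column-determines-row (firstRowFixed (signedPermutation m (toℕ q)))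
                       (firstRowFixed (signedPermutation m (toℕ p))) (suc (suc i)) (s≤s z≤n) (s≤s i<m)
                       (same-column (suc (suc i)) (s≤s z≤n) (s≤s i<m))
    ... | same-row , same-direction = suc-injective same-row , same-direction

  construction : ∀ (a : ℕ → ℕ) α β → Realises S α β →
    (∀ j → 1 ≤ j → j < K → a j ≡ (if isOdd j then α else β)) →
    Σ Graph (λ G → AdmissiblePathPartition (suc m) n a G ×
      Σ (Fin (2 ^ m * m !) → Labeling) (λ X →
        (∀ p → C4FaceMagicKBLabeling (suc m) n (X p) × SameGraph (LGraph (suc m) n (X p)) G) ×
        (∀ p q → ¬ p ≡ q → ¬ KBEquivalent (suc m) n (X p) (X q))))
  construction a α β (α≡ , β≡) a-alternating =
    pathGraph , PathPartition.pathPartition a a≡pathSum , labelingOf ,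
    (λ p → (LabelingOf.labeling-bijective p , LabelingOf.labeling-faceMagic p) , LabelingOf.LGraph≈pathGraph p) ,
    labelingOf-inequivalent
    where
    alternating≡pathSum : ∀ b → (if b then α else β) ≡ pathSum b
    alternating≡pathSum true = α≡
    alternating≡pathSum false = β≡
    a≡pathSum : ∀ j → 1 ≤ j → j < K → a j ≡ pathSum (isOdd j)
    a≡pathSum j 1≤j j<K = trans (a-alternating j 1≤j j<K) (alternating≡pathSum (isOdd j))

*-∸-+1 : ∀ m n c → c ≤ n → m * (n ∸ c) + 1 ≡ suc (m * n) ∸ m * c
*-∸-+1 m n c c≤n = begin
    m * (n ∸ c) + 1      ≡⟨ cong (_+ 1) (*-distribˡ-∸ m n c) ⟩
    m * n ∸ m * c + 1    ≡⟨ +-comm (m * n ∸ m * c) 1 ⟩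
    suc (m * n ∸ m * c)  ≡⟨ +-∸-assoc 1 (*-monoʳ-≤ m c≤n) ⟨
    suc (m * n) ∸ m * c  ∎
  where open ≡-Reasoning

*-+-+1 : ∀ m n c → m * (n + c) + 1 ≡ suc (m * n) + m * c
*-+-+1 = solve-∀

-- The four sequences are a_j = N + 1 ∓ d for d = 1, 2, m, 2m, realised by the four schemes below.
schemeFor : ∀ m K α β →
  (α ≡ suc m * (suc K + suc K) × β ≡ suc m * (suc K + suc K) + 2) ⊎
  (α ≡ suc m * (suc K + suc K) ∸ 1 × β ≡ suc m * (suc K + suc K) + 3) ⊎
  (α ≡ suc m * (suc K + suc K ∸ 1) + 1 × β ≡ suc m * (suc K + suc K + 1) + 1) ⊎
  (α ≡ suc m * (suc K + suc K ∸ 2) + 1 × β ≡ suc m * (suc K + suc K + 2) + 1) →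
  Σ (LabelScheme (suc m) (suc K)) λ S → Realises S α β
schemeFor m K α β (inj₁ (α≡ , β≡)) =
  HalfScheme.scheme (rowMajor (suc m) K) , α≡ , trans β≡ (+-suc (suc m * (suc K + suc K)) 1)
schemeFor m K α β (inj₂ (inj₁ (α≡ , β≡))) =
  DoubledScheme.scheme (rowMajor (suc m) K) , α≡ , trans β≡ (+-suc (suc m * (suc K + suc K)) 2)
schemeFor m K α β (inj₂ (inj₂ (inj₁ (α≡ , β≡)))) =
  HalfScheme.scheme (columnMajor m (suc K)) ,
  trans α≡ (trans (*-∸-+1 (suc m) n 1 (s≤s z≤n)) (cong (suc (suc m * n) ∸_) (*-identityʳ (suc m)))) ,
  trans β≡ (trans (*-+-+1 (suc m) n 1) (cong (suc (suc m * n) +_) (*-identityʳ (suc m))))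
  where
  n : ℕ
  n = suc K + suc K
schemeFor m K α β (inj₂ (inj₂ (inj₂ (α≡ , β≡)))) =
  DoubledScheme.scheme (columnMajor m (suc K)) ,
  trans α≡ (trans (*-∸-+1 (suc m) n 2 (+-mono-≤ (s≤s z≤n) (s≤s z≤n)))
                  (cong (suc (suc m * n) ∸_) (*-comm (suc m) 2))) ,
  trans β≡ (trans (*-+-+1 (suc m) n 2) (cong (suc (suc m * n) +_) (*-comm (suc m) 2)))
  where
  n : ℕ
  n = suc K + suc K

2∣⇒double : ∀ n → 2 ∣ n → ∃ λ h → n ≡ h + h
2∣⇒double n (divides h n≡) = h , trans n≡ (sym (double≡*2 h))

proposition7p4 : (m n : ℕ) (a : ℕ → ℕ) →
    3 ≤ m → ¬ (2 ∣ m) → 6 ≤ n → 2 ∣ n → 2 ∣ (n / 2) →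
    SeqCase m n a →
    Palindrome (aSeq n a) ×
    Σ Graph (λ K → AdmissiblePathPartition m n a K ×
      Σ (Fin (2 ^ (m ∸ 1) * (m ∸ 1) !) → Labeling) (λ X →
        (∀ p → C4FaceMagicKBLabeling m n (X p) × SameGraph (LGraph m n (X p)) K) ×
        (∀ p q → ¬ p ≡ q → ¬ KBEquivalent m n (X p) (X q))))
proposition7p4 (suc m) n a _ ¬2∣m 6≤n 2∣n 2∣n/2 (α , β , cases , odd-α , even-β) with 2∣⇒double n 2∣n
... | zero , refl = ⊥-elim (<⇒≱ 6≤n z≤n)
... | suc K , refl with 2∣⇒double _ 2∣n/2
...   | R , n/2≡ =
  palindrome ,
  Construction.construction (s≤s z≤n) m-odd (proj₁ scheme) a α β (proj₂ scheme)
    (λ j 1≤j j< → a-alternating j 1≤j (subst (j <_) K≡R+R j<))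
  where
  m-odd : isOdd (suc m) ≡ true
  m-odd = ¬2∣⇒isOdd (suc m) ¬2∣m
  scheme : Σ (LabelScheme (suc m) (suc K)) λ S → Realises S α β
  scheme = schemeFor m K α β cases
  K≡R+R : suc K ≡ R + R
  K≡R+R = trans (sym (double/2 (suc K))) n/2≡
  n/4≡R : (suc K + suc K) / 2 / 2 ≡ R
  n/4≡R = trans (cong (_/ 2) n/2≡) (double/2 R)
  a-alternating : ∀ j → 1 ≤ j → j < R + R → a j ≡ (if isOdd j then α else β)
  a-alternating = seqCase-alternating α β R a
    (λ k 1≤k k≤ → odd-α k 1≤k (subst (k ≤_) (sym n/4≡R) k≤))
    (λ k 1≤k k≤ → even-β k 1≤k (subst (λ x → k ≤ x ∸ 1) (sym n/4≡R) k≤))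
  1≤R : 1 ≤ R
  1≤R = 1≤double⇒1≤ R (subst (1 ≤_) K≡R+R (s≤s z≤n))
  palindrome : Palindrome (aSeq (suc K + suc K) a)
  palindrome = subst (λ L → Palindrome (map (λ j → a (suc j)) (upTo L)))
                     (sym (cong (_∸ 1) (trans (double/2 (suc K)) K≡R+R)))
                     (alternating-sequence-palindrome α β R a 1≤R a-alternating)
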